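{- For all integers $n\geq r\geq 1$, $$\left[ p_{n}^{(r)}\right]_q=\sum_{j=r}^{n}(1-q)^{j-r}\,S_q[j,r]\,p_n^{(j)}.$$
   Context: Let $\Lambda$ be the ring of symmetric functions in infinitely many variables $x_1,x_2,\dots$ with coefficients in $\mathbb{Q}(q)$; $e_n$ are the elementary symmetric functions ($e_0=1$), $E(t)=\sum_{n\geq0}e_nt^n$, and $m_\lambda$ the monomial symmetric functions. For $n\geq r\geq 1$, $p_n^{(r)}=\sum m_\lambda$, the sum over all integer partitions $\lambda$ of $n$ with exactly $r$ parts. For $n\geq1$, $[n]_q=1+q+\dots+q^{n-1}$, $[0]_q=0$, $[n]_q!=[1]_q\cdots[n]_q$, $[0]_q!=1$. The $q$-derivative is $D_qF(t)=\frac{F(qt)-F(t)}{(q-1)t}$, $D_q^0F=F$, $D_q^r=D_q\circ D_q^{r-1}$. The elements $\left[ p_{n}^{(r)}\right]_q$ ($n\geq r\geq0$) are defined by $\sum_{n\geq r}\left[ p_{n}^{(r)}\right]_q(-t)^{n-r}=\frac{1}{[r]_q!}\frac{D_q^rE(t)}{E(t)}$. The Carlitz $q$-Stirling numbers of the second kind $S_q[n,k]$ ($n,k\geq 0$) are defined by $S_q[n,0]=\delta_{n,0}$, $S_q[n,k]=0$ if $k>n$, and $S_q[n,k]=S_q[n-1,k-1]+[k]_qS_q[n-1,k]$ for $n\geq k\geq 1$. -}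

module Defs where

open import Data.Nat as ℕ using (ℕ; zero; suc; _∸_)
open import Data.List using (List; []; _∷_; map; foldr; concatMap; upTo; replicate; length)
open import Data.List.Properties using (≡-dec)
open import Data.Product using (_×_; _,_)
open import Data.Rational as ℚ using (ℚ; 0ℚ; 1ℚ)
open import Data.Bool using (Bool; true; false; if_then_else_; _∧_)
open import Relation.Binary.PropositionalEquality using (_≡_)
open import Relation.Nullary using (does)

-- Polynomials in q over ℚ (coefficient lists, lowest degree first)

Poly : Set
Poly = List ℚ

infixl 6 _+P_
infixl 7 _*P_

_+P_ : Poly → Poly → Poly
[] +P g = g
(a ∷ f) +P [] = a ∷ f
(a ∷ f) +P (b ∷ g) = (a ℚ.+ b) ∷ (f +P g)

scaleP : ℚ → Poly → Poly
scaleP c = map (c ℚ.*_)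

_*P_ : Poly → Poly → Poly
[] *P g = []
(a ∷ f) *P g = scaleP a g +P (0ℚ ∷ (f *P g))

negP : Poly → Poly
negP = map (λ a → ℚ.- a)

coeffP : Poly → ℕ → ℚ
coeffP [] _ = 0ℚ
coeffP (a ∷ f) zero = a
coeffP (a ∷ f) (suc i) = coeffP f i

_≈P_ : Poly → Poly → Set
f ≈P g = ∀ i → coeffP f i ≡ coeffP g i

oneP : Poly
oneP = 1ℚ ∷ []

qP : Poly
qP = 0ℚ ∷ 1ℚ ∷ []

powP : Poly → ℕ → Poly
powP p zero = oneP
powP p (suc k) = p *P powP p k

qint : ℕ → Poly
qint zero = []
qint (suc n) = oneP +P (qP *P qint n)

qfact : ℕ → Poly
qfact zero = oneP
qfact (suc n) = qint (suc n) *P qfact n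

-- The field ℚ(q) as fractions num/den of polynomials, with the usual
-- cross-multiplication equality.  (Only nonzero denominators are ever
-- formed below: products of 1, q-1 and [r]_q!.)

record K : Set where
  constructor _/_
  field
    num : Poly
    den : Poly
open K public

_≈K_ : K → K → Set
x ≈K y = (num x *P den y) ≈P (num y *P den x)

ofP : Poly → K
ofP p = p / oneP

invP : Poly → K     -- 1/p, applied only to nonzero p
invP p = oneP / p

0K 1K : K
0K = ofP []
1K = ofP oneP

infixl 6 _+K_
infixl 7 _*K_

_+K_ : K → K → K
(a / b) +K (c / d) = ((a *P d) +P (c *P b)) / (b *P d)

_*K_ : K → K → K
(a / b) *K (c / d) = (a *P c) / (b *P d)

negK : K → K
negK (a / b) = negP a / b

sumK : List K → K
sumK = foldr _+K_ 0K

-- Formal power series in infinitely many variables x₁,x₂,… over ℚ(q).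
-- A monomial x^α is an exponent list α (finitely many variables;
-- trailing zeros are irrelevant for all series below).  Λ sits inside
-- this ring; an element is given by its coefficient function.

Mono : Set
Mono = List ℕ

Sym : Set
Sym = Mono → K

_≈S_ : Sym → Sym → Set
F ≈S G = ∀ α → F α ≈K G α

addS : Sym → Sym → Sym
addS F G α = F α +K G α

negS : Sym → Sym
negS F α = negK (F α)

scaleS : K → Sym → Sym
scaleS c F α = c *K F α

zeroS : Sym
zeroS α = 0K

sumS : List Sym → Sym
sumS = foldr addS zeroS

splits : Mono → List (Mono × Mono)
splits [] = ([] , []) ∷ []
splits (a ∷ α) =
  concatMap (λ i → map (λ { (β , γ) → (i ∷ β , (a ∸ i) ∷ γ) }) (splits α))
            (upTo (suc a))

mulS : Sym → Sym → Sym
mulS F G α = sumK (map (λ { (β , γ) → F β *K G γ }) (splits α))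

nz : Mono → List ℕ
nz [] = []
nz (zero ∷ α) = nz α
nz (suc a ∷ α) = suc a ∷ nz α

insD : ℕ → List ℕ → List ℕ
insD x [] = x ∷ []
insD x (y ∷ ys) = if y ℕ.<ᵇ x then x ∷ y ∷ ys else y ∷ insD x ys

sortD : List ℕ → List ℕ
sortD = foldr insD []

-- monomial symmetric function m_λ (λ a partition, parts weakly decreasing)
m : List ℕ → Sym
m λ' α = if does (≡-dec ℕ._≟_ λ' (sortD (nz α))) then 1K else 0K

e : ℕ → Sym
e n = m (replicate n 1)

sumN : List ℕ → ℕ
sumN = foldr ℕ._+_ 0

decr : List ℕ → Bool
decr [] = true
decr (x ∷ []) = true
decr (x ∷ y ∷ ys) = (y ℕ.≤ᵇ x) ∧ decr (y ∷ ys)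

cands : ℕ → ℕ → List (List ℕ)
cands n zero = [] ∷ []
cands n (suc r) = concatMap (λ a → map (suc a ∷_) (cands n r)) (upTo n)

filterB : {A : Set} → (A → Bool) → List A → List A
filterB p [] = []
filterB p (x ∷ xs) = if p x then x ∷ filterB p xs else filterB p xs

partitions : ℕ → ℕ → List (List ℕ)
partitions n r =
  filterB (λ λ' → decr λ' ∧ does (sumN λ' ℕ.≟ n)) (cands n r)

p : ℕ → ℕ → Sym
p n r = sumS (map m (partitions n r))

Ser : Set
Ser = ℕ → Sym

E : Ser
E = e

oneSer : Ser
oneSer zero = m []
oneSer (suc n) = zeroS

subSer : Ser → Ser → Ser
subSer A B n = addS (A n) (negS (B n))

scaleSer : K → Ser → Ser
scaleSer c A n = scaleS c (A n)

mulSer : Ser → Ser → Ser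
mulSer A B n = sumS (map (λ k → mulS (A k) (B (n ∸ k))) (upTo (suc n)))

powSer : Ser → ℕ → Ser
powSer A zero = oneSer
powSer A (suc k) = mulSer A (powSer A k)

-- inverse of a series with constant term 1:  1/F = Σ_k (1 - F)^k
invSer : Ser → Ser
invSer F n = sumS (map (λ k → powSer (subSer oneSer F) k n) (upTo (suc n)))

divSer : Ser → Ser → Ser
divSer A B = mulSer A (invSer B)

-- q-derivative  D_q F(t) = (F(qt) - F(t)) / ((q-1) t)
Dq : Ser → Ser
Dq F n = scaleS (invP (qP +P negP oneP))
           (addS (scaleS (ofP (powP qP (suc n))) (F (suc n))) (negS (F (suc n))))

DqPow : ℕ → Ser → Ser
DqPow zero F = F
DqPow (suc r) F = Dq (DqPow r F)

-- Σ_{n≥r} [p_n^(r)]_q (-t)^(n-r) = (1/[r]_q!) D_q^r E(t) / E(t)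
pqSeries : ℕ → Ser
pqSeries r = divSer (scaleSer (invP (qfact r)) (DqPow r E)) E

pq : ℕ → ℕ → Sym
pq n r = scaleS (ofP (powP (negP oneP) (n ∸ r))) (pqSeries r (n ∸ r))

Sq : ℕ → ℕ → Poly
Sq zero zero = oneP
Sq zero (suc k) = []
Sq (suc n) zero = []
Sq (suc n) (suc k) = Sq n k +P (qint (suc k) *P Sq n (suc k))

rangeFromTo : ℕ → ℕ → List ℕ
rangeFromTo r n = map (r ℕ.+_) (upTo (suc (n ∸ r)))

rhs : ℕ → ℕ → Sym
rhs n r = sumS (map (λ j → scaleS (ofP (powP (oneP +P negP qP) (j ∸ r) *P Sq j r)) (p n j))
                    (rangeFromTo r n))

-- A polynomial vanishing at infinitely
-- many rationals is zero, so it suffices to compare the two sides after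
-- specialising q to a rational c > 1, where no denominator ([r]_q!, q - 1)
-- vanishes.  At q = c all coefficients are explicit on a monomial x^α of weight
-- w with ℓ nonzero exponents: p_n^(j) has coefficient [w = n][ℓ = j], a product
-- e_j · g(weight) has coefficient C(ℓ, j) g(w - j), and 1/E(t) = Σ_n (-t)^n h_n.
-- Since D_q^r E(t) = Σ_k [k+1]_q ⋯ [k+r]_q e_{k+r} t^k, the coefficient of x^α in
-- [p_n^(r)]_q is [w = n] / [r]_q! times Σ_k (-1)^k [k+1]_q ⋯ [k+r]_q C(ℓ, r+k),
-- and this alternating sum is [r]_q! (1-q)^(ℓ-r) S_q[ℓ, r]: both satisfy the
-- recursion of the q-Stirling numbers, by Pascal's rule and
-- [r+1+k+1]_q = [r+1]_q + q^(r+1) [k+1]_q.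

module Submission where

open import Defs
open import Data.Nat as ℕ using (ℕ; zero; suc; _∸_; z≤n; s≤s; _≤_; _<_; _≥_)
import Data.Nat.Properties as ℕP
open import Data.List using (List; []; _∷_; map; length; concatMap; _++_; applyUpTo; upTo; replicate)
open import Data.List.Properties using (≡-dec)
open import Data.List.Relation.Unary.All as All using (All; []; _∷_)
open import Data.List.Relation.Unary.Linked using (Linked; []; [-]; _∷_)
open import Data.Bool using (Bool; true; false; if_then_else_; _∧_; T)
open import Data.Bool.ListAction using (all)
import Data.Bool.Properties as BP
open import Data.Product using (_×_; _,_; proj₁; proj₂)
open import Data.Sum using (inj₁; inj₂)
open import Data.Rational as ℚ using (ℚ; 0ℚ; 1ℚ; _+_; _*_; -_; _-_)
import Data.Rational.Properties as QP
open import Data.Rational.Solver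
open import Algebra.Bundles using (CommutativeMonoid)
open import Algebra.Properties.Group QP.+-0-group using (x∙y⁻¹≈ε⇒x≈y) renaming (∙-cancelʳ to +-cancelʳ)
import Algebra.Properties.CommutativeSemigroup as CommSemigroupProperties
open import Function.Bundles using (_⇔_; mk⇔; Equivalence)
open import Relation.Binary.PropositionalEquality hiding ([_])
open import Relation.Binary.Definitions using (tri<; tri≈; tri>)
open import Relation.Nullary using (yes; no; does; contradiction)
open import Relation.Nullary.Decidable using (dec-true; dec-false)
open +-*-Solver using (solve; _:+_; _:*_; :-_; _:-_; _:=_; con)

module +-CS = CommSemigroupProperties ℕP.+-commutativeSemigroup
module ∧-CS = CommSemigroupProperties (CommutativeMonoid.commutativeSemigroup BP.∧-commutativeMonoid)

infixr 8 _^_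

_^_ : ℚ → ℕ → ℚ
x ^ zero = 1ℚ
x ^ suc k = x * x ^ k

x*y≡0⇒y≡0 : ∀ x y → x ≢ 0ℚ → x * y ≡ 0ℚ → y ≡ 0ℚ
x*y≡0⇒y≡0 x y x≢0 xy≡0 = begin
  y                   ≡⟨ sym (QP.*-identityˡ y) ⟩
  1ℚ * y              ≡⟨ cong (_* y) (sym (QP.*-inverseˡ x)) ⟩
  ℚ.1/ x * x * y      ≡⟨ QP.*-assoc (ℚ.1/ x) x y ⟩
  ℚ.1/ x * (x * y)    ≡⟨ cong (ℚ.1/ x *_) xy≡0 ⟩
  ℚ.1/ x * 0ℚ         ≡⟨ QP.*-zeroʳ (ℚ.1/ x) ⟩
  0ℚ                  ∎
  where open ≡-Reasoning
        instance _ = ℚ.≢-nonZero x≢0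

*-≢0 : ∀ x y → x ≢ 0ℚ → y ≢ 0ℚ → x * y ≢ 0ℚ
*-≢0 x y x≢0 y≢0 xy≡0 = y≢0 (x*y≡0⇒y≡0 x y x≢0 xy≡0)

x-y≡0⇒x≡y : ∀ x y → x - y ≡ 0ℚ → x ≡ y
x-y≡0⇒x≡y = x∙y⁻¹≈ε⇒x≈y

-- Total inverse, with the junk value inv 0 = 0.
inv : ℚ → ℚ
inv x with x ℚ.≟ 0ℚ
... | yes _ = 0ℚ
... | no x≢0 = ℚ.1/ x where instance _ = ℚ.≢-nonZero x≢0

*-inv : ∀ x → x ≢ 0ℚ → x * inv x ≡ 1ℚ
*-inv x x≢0 with x ℚ.≟ 0ℚ
... | yes x≡0 = contradiction x≡0 x≢0
... | no x≢0′ = QP.*-inverseʳ x where instance _ = ℚ.≢-nonZero x≢0′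

inv-* : ∀ x y → x ≢ 0ℚ → y ≢ 0ℚ → inv (x * y) ≡ inv x * inv y
inv-* x y x≢0 y≢0 = begin
  inv (x * y)                                  ≡⟨ solve 1 (λ z → z := z :* (con 1ℚ :* con 1ℚ)) refl _ ⟩
  inv (x * y) * (1ℚ * 1ℚ)                      ≡⟨ cong₂ (λ s t → inv (x * y) * (s * t)) (sym (*-inv x x≢0)) (sym (*-inv y y≢0)) ⟩
  inv (x * y) * ((x * inv x) * (y * inv y))    ≡⟨ solve 5 (λ z x y a b → z :* ((x :* a) :* (y :* b)) := ((x :* y) :* z) :* (a :* b)) refl (inv (x * y)) x y (inv x) (inv y) ⟩
  ((x * y) * inv (x * y)) * (inv x * inv y)    ≡⟨ cong (_* (inv x * inv y)) (*-inv (x * y) (*-≢0 x y x≢0 y≢0)) ⟩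
  1ℚ * (inv x * inv y)                         ≡⟨ QP.*-identityˡ _ ⟩
  inv x * inv y                                ∎
  where open ≡-Reasoning

x<1+x : ∀ x → x ℚ.< 1ℚ + x
x<1+x x = subst (ℚ._< 1ℚ + x) (QP.+-identityˡ x) (QP.+-monoˡ-< x (QP.positive⁻¹ 1ℚ))

0<1+x : ∀ x → 0ℚ ℚ.≤ x → 0ℚ ℚ.< 1ℚ + x
0<1+x x 0≤x = subst (ℚ._< 1ℚ + x) (QP.+-identityˡ 0ℚ) (QP.+-mono-<-≤ (QP.positive⁻¹ 1ℚ) 0≤x)

0≤x*y : ∀ {x y} → 0ℚ ℚ.≤ x → 0ℚ ℚ.≤ y → 0ℚ ℚ.≤ x * y
0≤x*y {x} {y} 0≤x 0≤y = subst (ℚ._≤ x * y) (QP.*-zeroʳ x) (QP.*-monoˡ-≤-nonNeg x {{ℚ.nonNegative 0≤x}} 0≤y)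

cross-multiply : ∀ a b c d → b ≢ 0ℚ → d ≢ 0ℚ → a * inv b ≡ c * inv d → a * d ≡ c * b
cross-multiply a b c d b≢0 d≢0 a/b≡c/d = begin
  a * d                             ≡⟨ solve 2 (λ a d → a :* d := a :* con 1ℚ :* d) refl a d ⟩
  a * 1ℚ * d                        ≡⟨ cong (λ t → a * t * d) (sym (*-inv b b≢0)) ⟩
  a * (b * inv b) * d               ≡⟨ solve 4 (λ a b i d → a :* (b :* i) :* d := a :* i :* (b :* d)) refl a b (inv b) d ⟩
  a * inv b * (b * d)               ≡⟨ cong (_* (b * d)) a/b≡c/d ⟩
  c * inv d * (b * d)               ≡⟨ solve 4 (λ c i b d → c :* i :* (b :* d) := c :* b :* (d :* i)) refl c (inv d) b d ⟩
  c * b * (d * inv d)               ≡⟨ cong (c * b *_) (*-inv d d≢0) ⟩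
  c * b * 1ℚ                        ≡⟨ QP.*-identityʳ _ ⟩
  c * b                             ∎
  where open ≡-Reasoning

-- Polynomials in q

eval : ℚ → Poly → ℚ
eval c [] = 0ℚ
eval c (a ∷ f) = a + c * eval c f

coeff-+P : ∀ f g i → coeffP (f +P g) i ≡ coeffP f i + coeffP g i
coeff-+P [] g i = sym (QP.+-identityˡ _)
coeff-+P (a ∷ f) [] i = sym (QP.+-identityʳ _)
coeff-+P (a ∷ f) (b ∷ g) zero = refl
coeff-+P (a ∷ f) (b ∷ g) (suc i) = coeff-+P f g i

coeff-negP : ∀ f i → coeffP (negP f) i ≡ - coeffP f i
coeff-negP [] i = refl
coeff-negP (a ∷ f) zero = refl
coeff-negP (a ∷ f) (suc i) = coeff-negP f i

eval-+P : ∀ c f g → eval c (f +P g) ≡ eval c f + eval c g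
eval-+P c [] g = sym (QP.+-identityˡ _)
eval-+P c (a ∷ f) [] = sym (QP.+-identityʳ _)
eval-+P c (a ∷ f) (b ∷ g) rewrite eval-+P c f g =
  solve 5 (λ a b c x y → (a :+ b) :+ c :* (x :+ y) := (a :+ c :* x) :+ (b :+ c :* y)) refl a b c (eval c f) (eval c g)

eval-scaleP : ∀ c a f → eval c (scaleP a f) ≡ a * eval c f
eval-scaleP c a [] = sym (QP.*-zeroʳ a)
eval-scaleP c a (b ∷ f) rewrite eval-scaleP c a f =
  solve 4 (λ a b c x → a :* b :+ c :* (a :* x) := a :* (b :+ c :* x)) refl a b c (eval c f)

eval-*P : ∀ c f g → eval c (f *P g) ≡ eval c f * eval c g
eval-*P c [] g = sym (QP.*-zeroˡ (eval c g))
eval-*P c (a ∷ f) g rewrite eval-+P c (scaleP a g) (0ℚ ∷ (f *P g)) | eval-scaleP c a g | eval-*P c f g =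
  solve 4 (λ a c x y → a :* y :+ (con 0ℚ :+ c :* (x :* y)) := (a :+ c :* x) :* y) refl a c (eval c f) (eval c g)

eval-negP : ∀ c f → eval c (negP f) ≡ - eval c f
eval-negP c [] = refl
eval-negP c (a ∷ f) rewrite eval-negP c f =
  solve 3 (λ a c x → (:- a) :+ c :* (:- x) := :- (a :+ c :* x)) refl a c (eval c f)

eval-oneP : ∀ c → eval c oneP ≡ 1ℚ
eval-oneP c = solve 1 (λ c → con 1ℚ :+ c :* con 0ℚ := con 1ℚ) refl c

eval-qP : ∀ c → eval c qP ≡ c
eval-qP c = solve 1 (λ c → con 0ℚ :+ c :* (con 1ℚ :+ c :* con 0ℚ) := c) refl c

eval-powP : ∀ c f k → eval c (powP f k) ≡ eval c f ^ k
eval-powP c f zero = eval-oneP c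
eval-powP c f (suc k) rewrite eval-*P c f (powP f k) | eval-powP c f k = refl

eval-q-1 : ∀ c → eval c (qP +P negP oneP) ≡ c - 1ℚ
eval-q-1 c = trans (eval-+P c qP (negP oneP))
                   (cong₂ _+_ (eval-qP c) (trans (eval-negP c oneP) (cong -_ (eval-oneP c))))

eval-1-q : ∀ c → eval c (oneP +P negP qP) ≡ 1ℚ - c
eval-1-q c = trans (eval-+P c oneP (negP qP))
                   (cong₂ _+_ (eval-oneP c) (trans (eval-negP c qP) (cong -_ (eval-qP c))))

eval-[-1]^ : ∀ c k → eval c (powP (negP oneP) k) ≡ (- 1ℚ) ^ k
eval-[-1]^ c k = trans (eval-powP c (negP oneP) k)
                       (cong (_^ k) (trans (eval-negP c oneP) (cong -_ (eval-oneP c))))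

IsZeroP : Poly → Set
IsZeroP f = ∀ i → coeffP f i ≡ 0ℚ

synDiv : ℚ → Poly → Poly
synDiv c [] = []
synDiv c (a ∷ []) = []
synDiv c (a ∷ b ∷ f) = eval c (b ∷ f) ∷ synDiv c (b ∷ f)

length-synDiv : ∀ c f → length (synDiv c f) ≡ length f ∸ 1
length-synDiv c [] = refl
length-synDiv c (a ∷ []) = refl
length-synDiv c (a ∷ b ∷ f) = cong suc (length-synDiv c (b ∷ f))

eval-synDiv : ∀ c x f → eval x f ≡ eval c f + (x - c) * eval x (synDiv c f)
eval-synDiv c x [] = solve 2 (λ c x → con 0ℚ := con 0ℚ :+ (x :- c) :* con 0ℚ) refl c x
eval-synDiv c x (a ∷ []) =
  solve 3 (λ a c x → a :+ x :* con 0ℚ := (a :+ c :* con 0ℚ) :+ (x :- c) :* con 0ℚ) refl a c x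
eval-synDiv c x (a ∷ b ∷ f) rewrite eval-synDiv c x (b ∷ f) =
  solve 5 (λ a c x e q → a :+ x :* (e :+ (x :- c) :* q) := (a :+ c :* e) :+ (x :- c) :* (e :+ x :* q))
    refl a c x (eval c (b ∷ f)) (eval x (synDiv c (b ∷ f)))

root∧IsZero-synDiv⇒IsZeroP : ∀ c f → eval c f ≡ 0ℚ → IsZeroP (synDiv c f) → IsZeroP f
root∧IsZero-synDiv⇒IsZeroP c [] _ _ i = refl
root∧IsZero-synDiv⇒IsZeroP c (a ∷ []) f[c]≡0 _ zero =
  trans (solve 2 (λ a c → a := a :+ c :* con 0ℚ) refl a c) f[c]≡0
root∧IsZero-synDiv⇒IsZeroP c (a ∷ []) _ _ (suc i) = refl
root∧IsZero-synDiv⇒IsZeroP c (a ∷ b ∷ f) f[c]≡0 q≡0 zero = begin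
  a                   ≡⟨ solve 2 (λ a c → a := a :+ c :* con 0ℚ) refl a c ⟩
  a + c * 0ℚ          ≡⟨ cong (λ t → a + c * t) (sym (q≡0 0)) ⟩
  eval c (a ∷ b ∷ f)  ≡⟨ f[c]≡0 ⟩
  0ℚ                  ∎
  where open ≡-Reasoning
root∧IsZero-synDiv⇒IsZeroP c (a ∷ b ∷ f) _ q≡0 (suc i) =
  root∧IsZero-synDiv⇒IsZeroP c (b ∷ f) (q≡0 0) (λ i → q≡0 (suc i)) i

module _ (pt : ℕ → ℚ) (pt-injective : ∀ {k n} → k ℕ.< n → pt k ≢ pt n) where

  vanishes⇒IsZeroP : ∀ n f → length f ℕ.≤ n → (∀ k → k ℕ.< n → eval (pt k) f ≡ 0ℚ) → IsZeroP f
  vanishes⇒IsZeroP zero [] _ _ = λ _ → refl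
  vanishes⇒IsZeroP (suc n) f len≤ roots =
    root∧IsZero-synDiv⇒IsZeroP (pt n) f (roots n ℕP.≤-refl) (vanishes⇒IsZeroP n q len-q roots-q)
    where
      q = synDiv (pt n) f
      len-q : length q ℕ.≤ n
      len-q = subst (ℕ._≤ n) (sym (length-synDiv (pt n) f)) (ℕP.∸-monoˡ-≤ 1 len≤)
      roots-q : ∀ k → k ℕ.< n → eval (pt k) q ≡ 0ℚ
      roots-q k k<n = x*y≡0⇒y≡0 (pt k - pt n) (eval (pt k) q) k-n≢0 (begin
        (pt k - pt n) * eval (pt k) q
          ≡⟨ solve 2 (λ a b → a := (b :+ a) :- b) refl _ (eval (pt n) f) ⟩
        (eval (pt n) f + (pt k - pt n) * eval (pt k) q) - eval (pt n) f
          ≡⟨ cong (_- eval (pt n) f) (sym (eval-synDiv (pt n) (pt k) f)) ⟩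
        eval (pt k) f - eval (pt n) f
          ≡⟨ cong₂ _-_ (roots k (ℕP.m<n⇒m<1+n k<n)) (roots n ℕP.≤-refl) ⟩
        0ℚ ∎)
        where
          open ≡-Reasoning
          k-n≢0 : pt k - pt n ≢ 0ℚ
          k-n≢0 k-n≡0 = pt-injective k<n (x-y≡0⇒x≡y _ _ k-n≡0)

ΣL : {A : Set} → (A → ℚ) → List A → ℚ
ΣL f [] = 0ℚ
ΣL f (x ∷ xs) = f x + ΣL f xs

ΣL-cong : {A : Set} {f g : A → ℚ} (xs : List A) → (∀ x → f x ≡ g x) → ΣL f xs ≡ ΣL g xs
ΣL-cong [] f≗g = refl
ΣL-cong (x ∷ xs) f≗g = cong₂ _+_ (f≗g x) (ΣL-cong xs f≗g)

ΣL-map : {A B : Set} (f : B → ℚ) (h : A → B) (xs : List A) → ΣL f (map h xs) ≡ ΣL (λ x → f (h x)) xs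
ΣL-map f h [] = refl
ΣL-map f h (x ∷ xs) = cong (f (h x) +_) (ΣL-map f h xs)

ΣL-++ : {A : Set} (f : A → ℚ) (xs ys : List A) → ΣL f (xs ++ ys) ≡ ΣL f xs + ΣL f ys
ΣL-++ f [] ys = sym (QP.+-identityˡ _)
ΣL-++ f (x ∷ xs) ys rewrite ΣL-++ f xs ys = sym (QP.+-assoc (f x) (ΣL f xs) (ΣL f ys))

ΣL-concatMap : {A B : Set} (f : B → ℚ) (h : A → List B) (xs : List A) →
               ΣL f (concatMap h xs) ≡ ΣL (λ x → ΣL f (h x)) xs
ΣL-concatMap f h [] = refl
ΣL-concatMap f h (x ∷ xs) = trans (ΣL-++ f (h x) (concatMap h xs)) (cong (ΣL f (h x) +_) (ΣL-concatMap f h xs))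

ΣL-+ : {A : Set} (f g : A → ℚ) (xs : List A) → ΣL (λ x → f x + g x) xs ≡ ΣL f xs + ΣL g xs
ΣL-+ f g [] = refl
ΣL-+ f g (x ∷ xs) rewrite ΣL-+ f g xs =
  solve 4 (λ a b c d → (a :+ b) :+ (c :+ d) := (a :+ c) :+ (b :+ d)) refl (f x) (g x) (ΣL f xs) (ΣL g xs)

ΣL-*ˡ : {A : Set} (a : ℚ) (f : A → ℚ) (xs : List A) → ΣL (λ x → a * f x) xs ≡ a * ΣL f xs
ΣL-*ˡ a f [] = sym (QP.*-zeroʳ a)
ΣL-*ˡ a f (x ∷ xs) rewrite ΣL-*ˡ a f xs = sym (QP.*-distribˡ-+ a (f x) (ΣL f xs))

ΣL-neg : {A : Set} (f : A → ℚ) (xs : List A) → ΣL (λ x → - f x) xs ≡ - ΣL f xs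
ΣL-neg f [] = refl
ΣL-neg f (x ∷ xs) rewrite ΣL-neg f xs = sym (QP.neg-distrib-+ (f x) (ΣL f xs))

ΣL-- : {A : Set} (f g : A → ℚ) (xs : List A) → ΣL (λ x → f x - g x) xs ≡ ΣL f xs - ΣL g xs
ΣL-- f g xs = trans (ΣL-+ f (λ x → - g x) xs) (cong (ΣL f xs +_) (ΣL-neg g xs))

ΣL-0 : {A : Set} (f : A → ℚ) (xs : List A) → (∀ x → f x ≡ 0ℚ) → ΣL f xs ≡ 0ℚ
ΣL-0 f [] f≡0 = refl
ΣL-0 f (x ∷ xs) f≡0 rewrite f≡0 x | ΣL-0 f xs f≡0 = refl

Σ< : (ℕ → ℚ) → ℕ → ℚ
Σ< f zero = 0ℚ
Σ< f (suc n) = f 0 + Σ< (λ i → f (suc i)) n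

ΣL-applyUpTo : (f : ℕ → ℚ) (g : ℕ → ℕ) (n : ℕ) → ΣL f (applyUpTo g n) ≡ Σ< (λ i → f (g i)) n
ΣL-applyUpTo f g zero = refl
ΣL-applyUpTo f g (suc n) = cong (f (g 0) +_) (ΣL-applyUpTo f (λ i → g (suc i)) n)

ΣL-upTo : (f : ℕ → ℚ) (n : ℕ) → ΣL f (upTo n) ≡ Σ< f n
ΣL-upTo f = ΣL-applyUpTo f (λ i → i)

Σ<-cong : ∀ {f g : ℕ → ℚ} n → (∀ i → i ℕ.< n → f i ≡ g i) → Σ< f n ≡ Σ< g n
Σ<-cong zero f≗g = refl
Σ<-cong (suc n) f≗g = cong₂ _+_ (f≗g 0 (s≤s z≤n)) (Σ<-cong n (λ i i<n → f≗g (suc i) (s≤s i<n)))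

Σ<-cong′ : ∀ {f g : ℕ → ℚ} n → (∀ i → f i ≡ g i) → Σ< f n ≡ Σ< g n
Σ<-cong′ n f≗g = Σ<-cong n (λ i _ → f≗g i)

Σ<-0 : ∀ (f : ℕ → ℚ) n → (∀ i → i ℕ.< n → f i ≡ 0ℚ) → Σ< f n ≡ 0ℚ
Σ<-0 f zero f≡0 = refl
Σ<-0 f (suc n) f≡0 rewrite f≡0 0 (s≤s z≤n) | Σ<-0 (λ i → f (suc i)) n (λ i i<n → f≡0 (suc i) (s≤s i<n)) = refl

Σ<-+ : ∀ (f g : ℕ → ℚ) n → Σ< (λ i → f i + g i) n ≡ Σ< f n + Σ< g n
Σ<-+ f g zero = refl
Σ<-+ f g (suc n) rewrite Σ<-+ (λ i → f (suc i)) (λ i → g (suc i)) n =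
  solve 4 (λ a b c d → (a :+ b) :+ (c :+ d) := (a :+ c) :+ (b :+ d)) refl
    (f 0) (g 0) (Σ< (λ i → f (suc i)) n) (Σ< (λ i → g (suc i)) n)

Σ<-*ˡ : ∀ a (f : ℕ → ℚ) n → Σ< (λ i → a * f i) n ≡ a * Σ< f n
Σ<-*ˡ a f zero = sym (QP.*-zeroʳ a)
Σ<-*ˡ a f (suc n) rewrite Σ<-*ˡ a (λ i → f (suc i)) n = sym (QP.*-distribˡ-+ a (f 0) _)

Σ<-*ʳ : ∀ a (f : ℕ → ℚ) n → Σ< (λ i → f i * a) n ≡ Σ< f n * a
Σ<-*ʳ a f n = trans (Σ<-cong′ n (λ i → QP.*-comm (f i) a)) (trans (Σ<-*ˡ a f n) (QP.*-comm a (Σ< f n)))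

Σ<-neg : ∀ (f : ℕ → ℚ) n → Σ< (λ i → - f i) n ≡ - Σ< f n
Σ<-neg f zero = refl
Σ<-neg f (suc n) rewrite Σ<-neg (λ i → f (suc i)) n = sym (QP.neg-distrib-+ (f 0) _)

Σ<-- : ∀ (f g : ℕ → ℚ) n → Σ< (λ i → f i - g i) n ≡ Σ< f n - Σ< g n
Σ<-- f g n = trans (Σ<-+ f (λ i → - g i) n) (cong (Σ< f n +_) (Σ<-neg g n))

Σ<-comm : ∀ (f : ℕ → ℕ → ℚ) n m → Σ< (λ i → Σ< (λ j → f i j) m) n ≡ Σ< (λ j → Σ< (λ i → f i j) n) m
Σ<-comm f zero m = sym (Σ<-0 _ m (λ _ _ → refl))
Σ<-comm f (suc n) m rewrite Σ<-comm (λ i → f (suc i)) n m =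
  sym (Σ<-+ (λ j → f 0 j) (λ j → Σ< (λ i → f (suc i) j) n) m)

ΣL-Σ<-comm : {A : Set} (f : A → ℕ → ℚ) (xs : List A) (n : ℕ) →
             ΣL (λ x → Σ< (f x) n) xs ≡ Σ< (λ k → ΣL (λ x → f x k) xs) n
ΣL-Σ<-comm f [] n = sym (Σ<-0 _ n (λ _ _ → refl))
ΣL-Σ<-comm f (x ∷ xs) n rewrite ΣL-Σ<-comm f xs n = sym (Σ<-+ (f x) (λ k → ΣL (λ x → f x k) xs) n)

Σ<-+-split : ∀ (f : ℕ → ℚ) m n → Σ< f (m ℕ.+ n) ≡ Σ< f m + Σ< (λ i → f (m ℕ.+ i)) n
Σ<-+-split f zero n = sym (QP.+-identityˡ _)
Σ<-+-split f (suc m) n rewrite Σ<-+-split (λ i → f (suc i)) m n = sym (QP.+-assoc (f 0) _ _)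

Σ<-extend : ∀ (f : ℕ → ℚ) {m n} → m ℕ.≤ n → (∀ i → m ℕ.≤ i → f i ≡ 0ℚ) → Σ< f n ≡ Σ< f m
Σ<-extend f {m} {n} m≤n f≡0 = begin
  Σ< f n                                         ≡⟨ cong (Σ< f) (sym (ℕP.m+[n∸m]≡n m≤n)) ⟩
  Σ< f (m ℕ.+ (n ∸ m))                           ≡⟨ Σ<-+-split f m (n ∸ m) ⟩
  Σ< f m + Σ< (λ i → f (m ℕ.+ i)) (n ∸ m)        ≡⟨ cong (Σ< f m +_) (Σ<-0 _ (n ∸ m) (λ i _ → f≡0 (m ℕ.+ i) (ℕP.m≤m+n m i))) ⟩
  Σ< f m + 0ℚ                                    ≡⟨ QP.+-identityʳ _ ⟩
  Σ< f m                                         ∎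
  where open ≡-Reasoning

Σ<-telescope : ∀ (f : ℕ → ℚ) n → Σ< (λ i → f i - f (suc i)) n ≡ f 0 - f n
Σ<-telescope f zero = sym (QP.+-inverseʳ (f 0))
Σ<-telescope f (suc n) rewrite Σ<-telescope (λ i → f (suc i)) n =
  solve 3 (λ a b c → (a :- b) :+ (b :- c) := a :- c) refl (f 0) (f 1) (f (suc n))

[_] : Bool → ℚ
[ true ] = 1ℚ
[ false ] = 0ℚ

[]-∧ : ∀ a b → [ a ∧ b ] ≡ [ a ] * [ b ]
[]-∧ true b = sym (QP.*-identityˡ [ b ])
[]-∧ false b = sym (QP.*-zeroˡ [ b ])

Σ<-indicator : ∀ t n → Σ< (λ i → [ i ℕ.≡ᵇ t ]) n ≡ [ t ℕ.<ᵇ n ]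
Σ<-indicator t zero = refl
Σ<-indicator zero (suc n) = trans (cong (1ℚ +_) (Σ<-0 _ n (λ _ _ → refl))) (QP.+-identityʳ 1ℚ)
Σ<-indicator (suc t) (suc n) = trans (QP.+-identityˡ _) (Σ<-indicator t n)

Σ<-select : ∀ (f : ℕ → ℚ) {n} t → t ℕ.< n → Σ< (λ i → [ i ℕ.≡ᵇ t ] * f i) n ≡ f t
Σ<-select f {suc n} zero _ = begin
  1ℚ * f 0 + Σ< (λ i → 0ℚ * f (suc i)) n  ≡⟨ cong₂ _+_ (QP.*-identityˡ (f 0)) (Σ<-0 _ n (λ i _ → QP.*-zeroˡ (f (suc i)))) ⟩
  f 0 + 0ℚ                                ≡⟨ QP.+-identityʳ _ ⟩
  f 0                                     ∎
  where open ≡-Reasoning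
Σ<-select f {suc n} (suc t) (s≤s t<n) =
  trans (cong (_+ Σ< (λ i → [ i ℕ.≡ᵇ t ] * f (suc i)) n) (QP.*-zeroˡ (f 0)))
        (trans (QP.+-identityˡ _) (Σ<-select (λ i → f (suc i)) t t<n))

≡ᵇ-true : ∀ {m n} → m ≡ n → (m ℕ.≡ᵇ n) ≡ true
≡ᵇ-true {m} {n} = dec-true (m ℕ.≟ n)

≡ᵇ-false : ∀ {m n} → m ≢ n → (m ℕ.≡ᵇ n) ≡ false
≡ᵇ-false {m} {n} = dec-false (m ℕ.≟ n)

≡ᵇ-sym : ∀ m n → (m ℕ.≡ᵇ n) ≡ (n ℕ.≡ᵇ m)
≡ᵇ-sym zero zero = refl
≡ᵇ-sym zero (suc n) = refl
≡ᵇ-sym (suc m) zero = refl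
≡ᵇ-sym (suc m) (suc n) = ≡ᵇ-sym m n

≡ᵇ-guard : ∀ {w n} {x y : ℚ} → (w ≡ n → x ≡ y) → [ w ℕ.≡ᵇ n ] * x ≡ [ w ℕ.≡ᵇ n ] * y
≡ᵇ-guard {w} {n} {x} {y} x≡y with w ℕ.≟ n
... | yes w≡n = cong ([ w ℕ.≡ᵇ n ] *_) (x≡y w≡n)
... | no w≢n rewrite ≡ᵇ-false w≢n = trans (QP.*-zeroˡ x) (sym (QP.*-zeroˡ y))

≡ᵇ-cong-⇔ : ∀ {a b c d} → (a ≡ b ⇔ c ≡ d) → (a ℕ.≡ᵇ b) ≡ (c ℕ.≡ᵇ d)
≡ᵇ-cong-⇔ {a} {b} {c} {d} a≡b⇔c≡d with c ℕ.≟ d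
... | yes c≡d rewrite ≡ᵇ-true c≡d = dec-true (a ℕ.≟ b) (Equivalence.from a≡b⇔c≡d c≡d)
... | no c≢d rewrite ≡ᵇ-false c≢d = dec-false (a ℕ.≟ b) (λ a≡b → c≢d (Equivalence.to a≡b⇔c≡d a≡b))

Σ<-select-from : ∀ (f : ℕ → ℚ) r N s → (∀ j → j < r → f j ≡ 0ℚ) → s ≤ r ℕ.+ N →
                 Σ< (λ i → f (r ℕ.+ i) * [ s ℕ.≡ᵇ r ℕ.+ i ]) (suc N) ≡ f s
Σ<-select-from f r N s f<r≡0 s≤r+N with r ℕ.≤? s
... | yes r≤s = begin
  Σ< (λ i → f (r ℕ.+ i) * [ s ℕ.≡ᵇ r ℕ.+ i ]) (suc N)
    ≡⟨ Σ<-cong′ (suc N) (λ i → trans (cong (λ b → f (r ℕ.+ i) * [ b ]) (≡ᵇ-cong-⇔ (mk⇔ (to {i}) from))) (QP.*-comm (f (r ℕ.+ i)) [ i ℕ.≡ᵇ s ∸ r ])) ⟩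
  Σ< (λ i → [ i ℕ.≡ᵇ s ∸ r ] * f (r ℕ.+ i)) (suc N)
    ≡⟨ Σ<-select (λ i → f (r ℕ.+ i)) (s ∸ r) (s≤s (subst (s ∸ r ≤_) (ℕP.m+n∸m≡n r N) (ℕP.∸-monoˡ-≤ r s≤r+N))) ⟩
  f (r ℕ.+ (s ∸ r))
    ≡⟨ cong f (ℕP.m+[n∸m]≡n r≤s) ⟩
  f s ∎
  where
    open ≡-Reasoning
    to : ∀ {i} → s ≡ r ℕ.+ i → i ≡ s ∸ r
    to refl = sym (ℕP.m+n∸m≡n r _)
    from : ∀ {i} → i ≡ s ∸ r → s ≡ r ℕ.+ i
    from refl = sym (ℕP.m+[n∸m]≡n r≤s)
... | no r≰s = trans (Σ<-0 _ (suc N) (λ i _ → trans (cong (λ b → f (r ℕ.+ i) * [ b ]) (≡ᵇ-false (λ s≡r+i → r≰s (subst (r ≤_) (sym s≡r+i) (ℕP.m≤m+n r i)))))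
                                                    (QP.*-zeroʳ (f (r ℕ.+ i)))))
                     (sym (f<r≡0 s (ℕP.≰⇒> r≰s)))

sign : ℕ → ℚ
sign zero = 1ℚ
sign (suc n) = - sign n

sign-+ : ∀ a b → sign (a ℕ.+ b) ≡ sign a * sign b
sign-+ zero b = sym (QP.*-identityˡ _)
sign-+ (suc a) b rewrite sign-+ a b = QP.neg-distribˡ-* (sign a) (sign b)

sign-*-sign : ∀ a → sign a * sign a ≡ 1ℚ
sign-*-sign zero = refl
sign-*-sign (suc a) = trans (solve 1 (λ x → (:- x) :* (:- x) := x :* x) refl (sign a)) (sign-*-sign a)

sign-∸ : ∀ {k n} → k ℕ.≤ n → sign (n ∸ k) ≡ sign n * sign k
sign-∸ {k} {n} k≤n = begin
  sign (n ∸ k)                       ≡⟨ sym (QP.*-identityʳ _) ⟩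
  sign (n ∸ k) * 1ℚ                  ≡⟨ cong (sign (n ∸ k) *_) (sym (sign-*-sign k)) ⟩
  sign (n ∸ k) * (sign k * sign k)   ≡⟨ solve 2 (λ a b → a :* (b :* b) := b :* a :* b) refl (sign (n ∸ k)) (sign k) ⟩
  sign k * sign (n ∸ k) * sign k     ≡⟨ cong (_* sign k) (sym (sign-+ k (n ∸ k))) ⟩
  sign (k ℕ.+ (n ∸ k)) * sign k      ≡⟨ cong (λ m → sign m * sign k) (ℕP.m+[n∸m]≡n k≤n) ⟩
  sign n * sign k                    ∎
  where open ≡-Reasoning

[-1]^≡sign : ∀ k → (- 1ℚ) ^ k ≡ sign k
[-1]^≡sign zero = refl
[-1]^≡sign (suc k) = trans (cong (- 1ℚ *_) ([-1]^≡sign k)) (trans (sym (QP.neg-distribˡ-* 1ℚ (sign k))) (cong -_ (QP.*-identityˡ (sign k))))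

binom : ℕ → ℕ → ℚ
binom zero zero = 1ℚ
binom zero (suc j) = 0ℚ
binom (suc s) zero = 1ℚ
binom (suc s) (suc j) = binom s j + binom s (suc j)

binom-n-0 : ∀ s → binom s 0 ≡ 1ℚ
binom-n-0 zero = refl
binom-n-0 (suc s) = refl

binom-< : ∀ s j → s ℕ.< j → binom s j ≡ 0ℚ
binom-< zero (suc j) _ = refl
binom-< (suc s) (suc j) (s≤s s<j) = cong₂ _+_ (binom-< s j s<j) (binom-< s (suc j) (ℕP.m<n⇒m<1+n s<j))

alternating-binom : ∀ s M → s ℕ.< M → Σ< (λ k → sign k * binom s k) M ≡ [ s ℕ.≡ᵇ 0 ]
alternating-binom zero (suc M) _ = cong (1ℚ * 1ℚ +_) (Σ<-0 _ M (λ i _ → QP.*-zeroʳ (sign (suc i))))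
alternating-binom (suc s) (suc M) (s≤s s<M) = begin
  sign 0 * binom (suc s) 0 + Σ< (λ k → sign (suc k) * binom (suc s) (suc k)) M
    ≡⟨ cong (1ℚ * 1ℚ +_) (Σ<-cong′ M (λ k → solve 3 (λ a b c → (:- a) :* (b :+ c) := :- (a :* b) :- (a :* c)) refl (sign k) (binom s k) (binom s (suc k)))) ⟩
  1ℚ * 1ℚ + Σ< (λ k → - (sign k * binom s k) - sign k * binom s (suc k)) M
    ≡⟨ cong (1ℚ * 1ℚ +_) (trans (Σ<-- _ _ M) (cong (_- Σ< (λ k → sign k * binom s (suc k)) M) (Σ<-neg _ M))) ⟩
  1ℚ * 1ℚ + (- Σ< (λ k → sign k * binom s k) M - Σ< (λ k → sign k * binom s (suc k)) M)
    ≡⟨ cong₂ (λ a b → 1ℚ * 1ℚ + (- a - b)) (alternating-binom s M s<M) shifted ⟩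
  1ℚ * 1ℚ + (- [ s ℕ.≡ᵇ 0 ] - (1ℚ - [ s ℕ.≡ᵇ 0 ]))
    ≡⟨ solve 1 (λ x → con 1ℚ :* con 1ℚ :+ (:- x :- (con 1ℚ :- x)) := con 0ℚ) refl [ s ℕ.≡ᵇ 0 ] ⟩
  0ℚ ∎
  where
    open ≡-Reasoning
    tail≡ : Σ< (λ k → sign k * binom s k) (suc M) ≡ 1ℚ - Σ< (λ k → sign k * binom s (suc k)) M
    tail≡ = cong₂ _+_ (trans (QP.*-identityˡ _) (binom-n-0 s))
                      (trans (Σ<-cong′ M (λ k → sym (QP.neg-distribˡ-* (sign k) (binom s (suc k))))) (Σ<-neg _ M))
    shifted : Σ< (λ k → sign k * binom s (suc k)) M ≡ 1ℚ - [ s ℕ.≡ᵇ 0 ]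
    shifted = begin
      Σ< (λ k → sign k * binom s (suc k)) M
        ≡⟨ solve 1 (λ x → x := con 1ℚ :- (con 1ℚ :- x)) refl _ ⟩
      1ℚ - (1ℚ - Σ< (λ k → sign k * binom s (suc k)) M)
        ≡⟨ cong (λ t → 1ℚ - t) (sym tail≡) ⟩
      1ℚ - Σ< (λ k → sign k * binom s k) (suc M)
        ≡⟨ cong (λ t → 1ℚ - t) (alternating-binom s (suc M) (ℕP.m<n⇒m<1+n s<M)) ⟩
      1ℚ - [ s ℕ.≡ᵇ 0 ] ∎

-- Specialisation at q = c

QSym : Set
QSym = Mono → ℚ

QSer : Set
QSer = ℕ → QSym

mulQ : QSym → QSym → QSym
mulQ F G α = ΣL (λ βγ → F (proj₁ βγ) * G (proj₂ βγ)) (splits α)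

mulQSer : QSer → QSer → QSer
mulQSer A B n α = Σ< (λ k → mulQ (A k) (B (n ∸ k)) α) (suc n)

module AtPoint (c : ℚ) where

  Defined : K → Set
  Defined x = eval c (den x) ≢ 0ℚ

  evalK : K → ℚ
  evalK x = eval c (num x) * inv (eval c (den x))

  infix 4 _⇓_ _⇓S_ _⇓Ser_

  record _⇓_ (x : K) (v : ℚ) : Set where
    constructor mk⇓
    field
      defined : Defined x
      value   : evalK x ≡ v

  ⇓-≡ : ∀ {x u v} → x ⇓ u → u ≡ v → x ⇓ v
  ⇓-≡ (mk⇓ x-def x≡u) u≡v = mk⇓ x-def (trans x≡u u≡v)

  ⇓-+K : ∀ {x y u v} → x ⇓ u → y ⇓ v → x +K y ⇓ u + v
  ⇓-+K {a / b} {a′ / d} (mk⇓ b≢0 refl) (mk⇓ d≢0 refl) = mk⇓ bd≢0 (begin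
    eval c ((a *P d) +P (a′ *P b)) * inv (eval c (b *P d))
      ≡⟨ cong₂ _*_ (trans (eval-+P c (a *P d) (a′ *P b)) (cong₂ _+_ (eval-*P c a d) (eval-*P c a′ b)))
                   (trans (cong inv (eval-*P c b d)) (inv-* _ _ b≢0 d≢0)) ⟩
    (A * D + C * B) * (inv B * inv D)
      ≡⟨ solve 6 (λ A B C D iB iD → (A :* D :+ C :* B) :* (iB :* iD) := A :* iB :* (D :* iD) :+ C :* iD :* (B :* iB)) refl A B C D (inv B) (inv D) ⟩
    A * inv B * (D * inv D) + C * inv D * (B * inv B)
      ≡⟨ cong₂ (λ s t → A * inv B * s + C * inv D * t) (*-inv D d≢0) (*-inv B b≢0) ⟩
    A * inv B * 1ℚ + C * inv D * 1ℚ
      ≡⟨ cong₂ _+_ (QP.*-identityʳ (A * inv B)) (QP.*-identityʳ (C * inv D)) ⟩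
    A * inv B + C * inv D ∎)
    where
      open ≡-Reasoning
      A = eval c a
      B = eval c b
      C = eval c a′
      D = eval c d
      bd≢0 : eval c (b *P d) ≢ 0ℚ
      bd≢0 bd≡0 = *-≢0 B D b≢0 d≢0 (trans (sym (eval-*P c b d)) bd≡0)

  ⇓-*K : ∀ {x y u v} → x ⇓ u → y ⇓ v → x *K y ⇓ u * v
  ⇓-*K {a / b} {a′ / d} (mk⇓ b≢0 refl) (mk⇓ d≢0 refl) = mk⇓ bd≢0 (begin
    eval c (a *P a′) * inv (eval c (b *P d))
      ≡⟨ cong₂ _*_ (eval-*P c a a′) (trans (cong inv (eval-*P c b d)) (inv-* _ _ b≢0 d≢0)) ⟩
    eval c a * eval c a′ * (inv (eval c b) * inv (eval c d))
      ≡⟨ solve 4 (λ a b c d → a :* b :* (c :* d) := a :* c :* (b :* d)) refl (eval c a) (eval c a′) (inv (eval c b)) (inv (eval c d)) ⟩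
    eval c a * inv (eval c b) * (eval c a′ * inv (eval c d)) ∎)
    where
      open ≡-Reasoning
      bd≢0 : eval c (b *P d) ≢ 0ℚ
      bd≢0 bd≡0 = *-≢0 _ _ b≢0 d≢0 (trans (sym (eval-*P c b d)) bd≡0)

  ⇓-negK : ∀ {x v} → x ⇓ v → negK x ⇓ - v
  ⇓-negK {a / b} (mk⇓ b≢0 refl) = mk⇓ b≢0 (trans (cong (_* inv (eval c b)) (eval-negP c a)) (sym (QP.neg-distribˡ-* (eval c a) (inv (eval c b)))))

  ⇓-ofP : ∀ f → ofP f ⇓ eval c f
  ⇓-ofP f = mk⇓ (λ 1≡0 → QP.1≢0 (trans (sym (eval-oneP c)) 1≡0))
                (trans (cong (λ t → eval c f * inv t) (eval-oneP c)) (QP.*-identityʳ _))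

  ⇓-invP : ∀ f → eval c f ≢ 0ℚ → invP f ⇓ inv (eval c f)
  ⇓-invP f f≢0 = mk⇓ f≢0 (trans (cong (_* inv (eval c f)) (eval-oneP c)) (QP.*-identityˡ _))

  ⇓-0K : 0K ⇓ 0ℚ
  ⇓-0K = ⇓-ofP []

  ⇓-1K : 1K ⇓ 1ℚ
  ⇓-1K = ⇓-≡ (⇓-ofP oneP) (eval-oneP c)

  ⇓-if : ∀ b → (if b then 1K else 0K) ⇓ [ b ]
  ⇓-if true = ⇓-1K
  ⇓-if false = ⇓-0K

  ⇓-sumK : {A : Set} {f : A → K} {g : A → ℚ} (xs : List A) → (∀ x → f x ⇓ g x) → sumK (map f xs) ⇓ ΣL g xs
  ⇓-sumK [] f⇓g = ⇓-0K
  ⇓-sumK (x ∷ xs) f⇓g = ⇓-+K (f⇓g x) (⇓-sumK xs f⇓g)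

  _⇓S_ : Sym → QSym → Set
  F ⇓S f = ∀ α → F α ⇓ f α

  _⇓Ser_ : Ser → QSer → Set
  A ⇓Ser a = ∀ n → A n ⇓S a n

  ⇓S-mulS : ∀ {F G f g} → F ⇓S f → G ⇓S g → mulS F G ⇓S mulQ f g
  ⇓S-mulS F⇓f G⇓g α = ⇓-sumK (splits α) (λ βγ → ⇓-*K (F⇓f (proj₁ βγ)) (G⇓g (proj₂ βγ)))

  ⇓S-sumS : {A : Set} {h : A → Sym} {g : A → QSym} (xs : List A) → (∀ x → h x ⇓S g x) →
            sumS (map h xs) ⇓S (λ α → ΣL (λ x → g x α) xs)
  ⇓S-sumS [] h⇓g α = ⇓-0K
  ⇓S-sumS (x ∷ xs) h⇓g α = ⇓-+K (h⇓g x α) (⇓S-sumS xs h⇓g α)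

  ⇓Ser-mulSer : ∀ {A B a b} → A ⇓Ser a → B ⇓Ser b → mulSer A B ⇓Ser mulQSer a b
  ⇓Ser-mulSer {a = a} {b} A⇓a B⇓b n α =
    ⇓-≡ (⇓S-sumS (upTo (suc n)) (λ k → ⇓S-mulS (A⇓a k) (B⇓b (n ∸ k))) α)
        (ΣL-upTo (λ k → mulQ (a k) (b (n ∸ k)) α) (suc n))

  ⇓Ser-subSer : ∀ {A B a b} → A ⇓Ser a → B ⇓Ser b → subSer A B ⇓Ser (λ n α → a n α - b n α)
  ⇓Ser-subSer A⇓a B⇓b n α = ⇓-+K (A⇓a n α) (⇓-negK (B⇓b n α))

module _ (pt : ℕ → ℚ) (pt-injective : ∀ {k n} → k ℕ.< n → pt k ≢ pt n) where

  ≈K-byEvaluation : ∀ x y (v : ℕ → ℚ) → (∀ k → AtPoint._⇓_ (pt k) x (v k)) → (∀ k → AtPoint._⇓_ (pt k) y (v k)) → x ≈K y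
  ≈K-byEvaluation (a / b) (a′ / d) v x⇓v y⇓v i =
    x-y≡0⇒x≡y _ _ (trans (sym (trans (coeff-+P X (negP Y) i) (cong (coeffP X i +_) (coeff-negP Y i))))
                         (vanishes⇒IsZeroP pt pt-injective (length (X +P negP Y)) (X +P negP Y) ℕP.≤-refl
                                           (λ k _ → X-Y-root k) i))
    where
      X = a *P d
      Y = a′ *P b
      X-Y-root : ∀ k → eval (pt k) (X +P negP Y) ≡ 0ℚ
      X-Y-root k = begin
        eval c (X +P negP Y)
          ≡⟨ trans (eval-+P c X (negP Y)) (cong₂ _+_ (eval-*P c a d) (trans (eval-negP c Y) (cong -_ (eval-*P c a′ b)))) ⟩
        eval c a * eval c d - eval c a′ * eval c b
          ≡⟨ cong (λ t → eval c a * eval c d - t) (sym (cross-multiply (eval c a) (eval c b) (eval c a′) (eval c d) (defined (x⇓v k)) (defined (y⇓v k)) (trans (value (x⇓v k)) (sym (value (y⇓v k)))))) ⟩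
        eval c a * eval c d - eval c a * eval c d
          ≡⟨ QP.+-inverseʳ (eval c a * eval c d) ⟩
        0ℚ ∎
        where open ≡-Reasoning
              open AtPoint._⇓_
              c = pt k

-- Monomials and partitions

weight : Mono → ℕ
weight = sumN

nparts : Mono → ℕ
nparts α = length (nz α)

shape : Mono → List ℕ
shape α = sortD (nz α)

infix 4 _≟L_
_≟L_ : List ℕ → List ℕ → Bool
λ′ ≟L μ = does (≡-dec ℕ._≟_ λ′ μ)

length-insD : ∀ x xs → length (insD x xs) ≡ suc (length xs)
length-insD x [] = refl
length-insD x (y ∷ ys) with y ℕ.<ᵇ x
... | true = refl
... | false = cong suc (length-insD x ys)

sumN-insD : ∀ x xs → sumN (insD x xs) ≡ x ℕ.+ sumN xs
sumN-insD x [] = refl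
sumN-insD x (y ∷ ys) with y ℕ.<ᵇ x
... | true = refl
... | false rewrite sumN-insD x ys = +-CS.x∙yz≈y∙xz y x (sumN ys)

All-insD : ∀ {P : ℕ → Set} {x xs} → P x → All P xs → All P (insD x xs)
All-insD {xs = []} px [] = px ∷ []
All-insD {x = x} {y ∷ ys} px (py ∷ pys) with y ℕ.<ᵇ x
... | true = px ∷ py ∷ pys
... | false = py ∷ All-insD px pys

all-insD : ∀ (p : ℕ → Bool) x xs → all p (insD x xs) ≡ p x ∧ all p xs
all-insD p x [] = refl
all-insD p x (y ∷ ys) with y ℕ.<ᵇ x
... | true = refl
... | false rewrite all-insD p x ys = ∧-CS.x∙yz≈y∙xz (p y) (p x) (all p ys)

length-sortD : ∀ xs → length (sortD xs) ≡ length xs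
length-sortD [] = refl
length-sortD (x ∷ xs) = trans (length-insD x (sortD xs)) (cong suc (length-sortD xs))

sumN-sortD : ∀ xs → sumN (sortD xs) ≡ sumN xs
sumN-sortD [] = refl
sumN-sortD (x ∷ xs) = trans (sumN-insD x (sortD xs)) (cong (x ℕ.+_) (sumN-sortD xs))

All-sortD : ∀ {P : ℕ → Set} {xs} → All P xs → All P (sortD xs)
All-sortD [] = []
All-sortD (px ∷ pxs) = All-insD px (All-sortD pxs)

all-sortD : ∀ (p : ℕ → Bool) xs → all p (sortD xs) ≡ all p xs
all-sortD p [] = refl
all-sortD p (x ∷ xs) = trans (all-insD p x (sortD xs)) (cong (p x ∧_) (all-sortD p xs))

Decreasing : List ℕ → Set
Decreasing = Linked _≥_

insD-decreasing : ∀ x {xs} → Decreasing xs → Decreasing (insD x xs)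
insD-decreasing x [] = [-]
insD-decreasing x {y ∷ ys} ys↓ with y ℕ.<ᵇ x in y<ᵇx
... | true = ℕP.<⇒≤ (ℕP.<ᵇ⇒< y x (subst T (sym y<ᵇx) _)) ∷ ys↓
... | false = insD-below x y ys↓ (ℕP.≮⇒≥ (λ y<x → subst T y<ᵇx (ℕP.<⇒<ᵇ y<x)))
  where
    insD-below : ∀ x y {ys} → Decreasing (y ∷ ys) → x ≤ y → Decreasing (y ∷ insD x ys)
    insD-below x y [-] x≤y = x≤y ∷ [-]
    insD-below x y {z ∷ zs} (y≥z ∷ zs↓) x≤y with z ℕ.<ᵇ x in z<ᵇx
    ... | true = x≤y ∷ ℕP.<⇒≤ (ℕP.<ᵇ⇒< z x (subst T (sym z<ᵇx) _)) ∷ zs↓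
    ... | false = y≥z ∷ insD-below x z zs↓ (ℕP.≮⇒≥ (λ z<x → subst T z<ᵇx (ℕP.<⇒<ᵇ z<x)))

sortD-decreasing : ∀ xs → Decreasing (sortD xs)
sortD-decreasing [] = []
sortD-decreasing (x ∷ xs) = insD-decreasing x (sortD-decreasing xs)

decr-decreasing : ∀ {xs} → Decreasing xs → decr xs ≡ true
decr-decreasing [] = refl
decr-decreasing [-] = refl
decr-decreasing {x ∷ y ∷ ys} (x≥y ∷ ys↓) rewrite dec-true (y ℕ.≤? x) x≥y = decr-decreasing ys↓

sumN-nz : ∀ α → sumN (nz α) ≡ weight α
sumN-nz [] = refl
sumN-nz (zero ∷ α) = sumN-nz α
sumN-nz (suc a ∷ α) = cong (suc a ℕ.+_) (sumN-nz α)

weight-shape : ∀ α → sumN (shape α) ≡ weight α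
weight-shape α = trans (sumN-sortD (nz α)) (sumN-nz α)

length-shape : ∀ α → length (shape α) ≡ nparts α
length-shape α = length-sortD (nz α)

All-positive-nz : ∀ α → All (1 ≤_) (nz α)
All-positive-nz [] = []
All-positive-nz (zero ∷ α) = All-positive-nz α
All-positive-nz (suc a ∷ α) = s≤s z≤n ∷ All-positive-nz α

All-≤-sumN : ∀ xs → All (_≤ sumN xs) xs
All-≤-sumN [] = []
All-≤-sumN (x ∷ xs) = ℕP.m≤m+n x (sumN xs) ∷ All.map (λ {y} y≤ → ℕP.≤-trans y≤ (ℕP.m≤n+m (sumN xs) x)) (All-≤-sumN xs)

length≤sumN : ∀ {xs} → All (1 ≤_) xs → length xs ≤ sumN xs
length≤sumN [] = z≤n
length≤sumN (1≤x ∷ pos) = ℕP.+-mono-≤ 1≤x (length≤sumN pos)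

nparts≤weight : ∀ α → nparts α ≤ weight α
nparts≤weight α = subst (nparts α ≤_) (sumN-nz α) (length≤sumN (All-positive-nz α))

isElementary : ℕ → Mono → Bool
isElementary j α = all (ℕ._≡ᵇ 1) (nz α) ∧ (nparts α ℕ.≡ᵇ j)

eQ : ℕ → QSym
eQ j α = [ isElementary j α ]

replicate-≟L : ∀ j xs → (replicate j 1 ≟L xs) ≡ all (ℕ._≡ᵇ 1) xs ∧ (length xs ℕ.≡ᵇ j)
replicate-≟L zero [] = refl
replicate-≟L zero (x ∷ xs) = sym (BP.∧-zeroʳ _)
replicate-≟L (suc j) [] = refl
replicate-≟L (suc j) (x ∷ xs) rewrite replicate-≟L j xs | ≡ᵇ-sym 1 x =
  sym (BP.∧-assoc (x ℕ.≡ᵇ 1) (all (ℕ._≡ᵇ 1) xs) (length xs ℕ.≡ᵇ j))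

replicate-≟L-shape : ∀ j α → (replicate j 1 ≟L shape α) ≡ isElementary j α
replicate-≟L-shape j α rewrite replicate-≟L j (shape α) | all-sortD (ℕ._≡ᵇ 1) (nz α) | length-shape α = refl

isElementary-0 : ∀ α → isElementary 0 α ≡ (weight α ℕ.≡ᵇ 0)
isElementary-0 [] = refl
isElementary-0 (zero ∷ α) = isElementary-0 α
isElementary-0 (suc a ∷ α) = BP.∧-zeroʳ _

isElementary-0-suc : ∀ i α → isElementary 0 (suc i ∷ α) ≡ false
isElementary-0-suc i α = BP.∧-zeroʳ _

count : List (List ℕ) → List ℕ → ℚ
count xs μ = ΣL (λ λ′ → [ λ′ ≟L μ ]) xs

ΣL-filterB : (P : List ℕ → Bool) (f : List ℕ → ℚ) (xs : List (List ℕ)) → ΣL f (filterB P xs) ≡ ΣL (λ x → [ P x ] * f x) xs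
ΣL-filterB P f [] = refl
ΣL-filterB P f (x ∷ xs) with P x
... | true = cong₂ _+_ (sym (QP.*-identityˡ (f x))) (ΣL-filterB P f xs)
... | false = trans (ΣL-filterB P f xs) (sym (trans (cong (_+ _) (QP.*-zeroˡ (f x))) (QP.+-identityˡ _)))

count-filterB : ∀ P xs μ → count (filterB P xs) μ ≡ [ P μ ] * count xs μ
count-filterB P xs μ = trans (ΣL-filterB P _ xs) (trans (ΣL-cong xs term) (ΣL-*ˡ [ P μ ] _ xs))
  where
    term : ∀ x → [ P x ] * [ x ≟L μ ] ≡ [ P μ ] * [ x ≟L μ ]
    term x with ≡-dec ℕ._≟_ x μ
    ... | yes refl = refl
    ... | no _ = trans (QP.*-zeroʳ [ P x ]) (sym (QP.*-zeroʳ [ P μ ]))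

inCands : ℕ → ℕ → List ℕ → Bool
inCands n zero [] = true
inCands n zero (_ ∷ _) = false
inCands n (suc r) [] = false
inCands n (suc r) (x ∷ μ) = ((1 ℕ.≤ᵇ x) ∧ (x ℕ.≤ᵇ n)) ∧ inCands n r μ

count-cands : ∀ n r μ → count (cands n r) μ ≡ [ inCands n r μ ]
count-cands n zero [] = refl
count-cands n zero (x ∷ μ) = refl
count-cands n (suc r) μ = begin
  count (cands n (suc r)) μ
    ≡⟨ ΣL-concatMap _ (λ a → map (suc a ∷_) (cands n r)) (upTo n) ⟩
  ΣL (λ a → count (map (suc a ∷_) (cands n r)) μ) (upTo n)
    ≡⟨ ΣL-upTo _ n ⟩
  Σ< (λ a → count (map (suc a ∷_) (cands n r)) μ) n
    ≡⟨ Σ<-cong′ n (λ a → ΣL-map _ (suc a ∷_) (cands n r)) ⟩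
  Σ< (λ a → ΣL (λ λ′ → [ (suc a ∷ λ′) ≟L μ ]) (cands n r)) n
    ≡⟨ by-head μ ⟩
  [ inCands n (suc r) μ ] ∎
  where
    open ≡-Reasoning
    by-head : ∀ μ → Σ< (λ a → ΣL (λ λ′ → [ (suc a ∷ λ′) ≟L μ ]) (cands n r)) n ≡ [ inCands n (suc r) μ ]
    by-head [] = Σ<-0 _ n (λ a _ → ΣL-0 _ (cands n r) (λ _ → refl))
    by-head (zero ∷ μ′) = Σ<-0 _ n (λ a _ → ΣL-0 _ (cands n r) (λ _ → refl))
    by-head (suc x ∷ μ′) = begin
      Σ< (λ a → ΣL (λ λ′ → [ (a ℕ.≡ᵇ x) ∧ (λ′ ≟L μ′) ]) (cands n r)) n
        ≡⟨ Σ<-cong′ n (λ a → trans (ΣL-cong (cands n r) (λ λ′ → []-∧ (a ℕ.≡ᵇ x) _)) (ΣL-*ˡ [ a ℕ.≡ᵇ x ] (λ λ′ → [ λ′ ≟L μ′ ]) (cands n r))) ⟩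
      Σ< (λ a → [ a ℕ.≡ᵇ x ] * count (cands n r) μ′) n
        ≡⟨ Σ<-*ʳ _ (λ a → [ a ℕ.≡ᵇ x ]) n ⟩
      Σ< (λ a → [ a ℕ.≡ᵇ x ]) n * count (cands n r) μ′
        ≡⟨ cong₂ _*_ (Σ<-indicator x n) (count-cands n r μ′) ⟩
      [ x ℕ.<ᵇ n ] * [ inCands n r μ′ ]
        ≡⟨ sym ([]-∧ (x ℕ.<ᵇ n) _) ⟩
      [ inCands n (suc r) (suc x ∷ μ′) ] ∎

inCands-length : ∀ {n} j {μ} → All (λ x → 1 ≤ x × x ≤ n) μ → inCands n j μ ≡ (length μ ℕ.≡ᵇ j)
inCands-length zero [] = refl
inCands-length (suc j) [] = refl
inCands-length zero (_ ∷ _) = refl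
inCands-length {n} (suc j) {x ∷ μ} ((1≤x , x≤n) ∷ bounded)
  rewrite dec-true (1 ℕ.≤? x) 1≤x | dec-true (x ℕ.≤? n) x≤n = inCands-length j bounded

count-partitions : ∀ n j α → count (partitions n j) (shape α) ≡ [ weight α ℕ.≡ᵇ n ] * [ nparts α ℕ.≡ᵇ j ]
count-partitions n j α = begin
  count (partitions n j) μ
    ≡⟨ count-filterB _ (cands n j) μ ⟩
  [ decr μ ∧ (sumN μ ℕ.≡ᵇ n) ] * count (cands n j) μ
    ≡⟨ cong₂ (λ d t → [ d ∧ (t ℕ.≡ᵇ n) ] * count (cands n j) μ) (decr-decreasing (sortD-decreasing (nz α))) (weight-shape α) ⟩
  [ weight α ℕ.≡ᵇ n ] * count (cands n j) μ
    ≡⟨ cong ([ weight α ℕ.≡ᵇ n ] *_) (count-cands n j μ) ⟩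
  [ weight α ℕ.≡ᵇ n ] * [ inCands n j μ ]
    ≡⟨ ≡ᵇ-guard {weight α} {n} (λ { refl → cong [_] (trans (inCands-length j bounded) (cong (ℕ._≡ᵇ j) (length-shape α))) }) ⟩
  [ weight α ℕ.≡ᵇ n ] * [ nparts α ℕ.≡ᵇ j ] ∎
  where
    open ≡-Reasoning
    μ = shape α
    bounded : All (λ x → 1 ≤ x × x ≤ weight α) μ
    bounded = All.zip (All-sortD (All-positive-nz α) , subst (λ w → All (_≤ w) μ) (weight-shape α) (All-≤-sumN μ))

module _ (c : ℚ) where
  open AtPoint c

  e⇓ : ∀ j → e j ⇓S eQ j
  e⇓ j α = ⇓-≡ (⇓-if _) (cong [_] (replicate-≟L-shape j α))

  p⇓ : ∀ n j → p n j ⇓S (λ α → [ weight α ℕ.≡ᵇ n ] * [ nparts α ℕ.≡ᵇ j ])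
  p⇓ n j α = ⇓-≡ (⇓S-sumS (partitions n j) (λ λ′ β → ⇓-if _) α) (count-partitions n j α)

mulQ-∷ : ∀ F G a α → mulQ F G (a ∷ α) ≡ Σ< (λ i → mulQ (λ β → F (i ∷ β)) (λ γ → G ((a ∸ i) ∷ γ)) α) (suc a)
mulQ-∷ F G a α = begin
  mulQ F G (a ∷ α)
    ≡⟨ ΣL-concatMap f (λ i → map (λ βγ → (i ∷ proj₁ βγ , (a ∸ i) ∷ proj₂ βγ)) (splits α)) (upTo (suc a)) ⟩
  ΣL (λ i → ΣL f (map (λ βγ → (i ∷ proj₁ βγ , (a ∸ i) ∷ proj₂ βγ)) (splits α))) (upTo (suc a))
    ≡⟨ ΣL-upTo (λ i → ΣL f (map (λ βγ → (i ∷ proj₁ βγ , (a ∸ i) ∷ proj₂ βγ)) (splits α))) (suc a) ⟩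
  Σ< (λ i → ΣL f (map (λ βγ → (i ∷ proj₁ βγ , (a ∸ i) ∷ proj₂ βγ)) (splits α))) (suc a)
    ≡⟨ Σ<-cong′ (suc a) (λ i → ΣL-map f (λ βγ → (i ∷ proj₁ βγ , (a ∸ i) ∷ proj₂ βγ)) (splits α)) ⟩
  Σ< (λ i → mulQ (λ β → F (i ∷ β)) (λ γ → G ((a ∸ i) ∷ γ)) α) (suc a) ∎
  where
    open ≡-Reasoning
    f = λ βγ → F (proj₁ βγ) * G (proj₂ βγ)

mulQ-congˡ : ∀ {F F′} G α → (∀ β → F β ≡ F′ β) → mulQ F G α ≡ mulQ F′ G α
mulQ-congˡ G α F≗F′ = ΣL-cong (splits α) (λ βγ → cong (_* G (proj₂ βγ)) (F≗F′ (proj₁ βγ)))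

mulQ-congʳ : ∀ F {G G′} α → (∀ γ → G γ ≡ G′ γ) → mulQ F G α ≡ mulQ F G′ α
mulQ-congʳ F α G≗G′ = ΣL-cong (splits α) (λ βγ → cong (F (proj₁ βγ) *_) (G≗G′ (proj₂ βγ)))

mulQ-zeroˡ : ∀ F G α → (∀ β → F β ≡ 0ℚ) → mulQ F G α ≡ 0ℚ
mulQ-zeroˡ F G α F≡0 = ΣL-0 _ (splits α) (λ βγ → trans (cong (_* G (proj₂ βγ)) (F≡0 (proj₁ βγ))) (QP.*-zeroˡ (G (proj₂ βγ))))

mulQ-zeroʳ : ∀ F G α → (∀ γ → G γ ≡ 0ℚ) → mulQ F G α ≡ 0ℚ
mulQ-zeroʳ F G α G≡0 = ΣL-0 _ (splits α) (λ βγ → trans (cong (F (proj₁ βγ) *_) (G≡0 (proj₂ βγ))) (QP.*-zeroʳ (F (proj₁ βγ))))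

mulQ--ˡ : ∀ F F′ G α → mulQ (λ β → F β - F′ β) G α ≡ mulQ F G α - mulQ F′ G α
mulQ--ˡ F F′ G α =
  trans (ΣL-cong (splits α) (λ βγ → solve 3 (λ a b c → (a :- b) :* c := a :* c :- b :* c) refl (F (proj₁ βγ)) (F′ (proj₁ βγ)) (G (proj₂ βγ))))
        (ΣL-- _ _ (splits α))

mulQ-*ˡ : ∀ a F G α → mulQ (λ β → a * F β) G α ≡ a * mulQ F G α
mulQ-*ˡ a F G α = trans (ΣL-cong (splits α) (λ βγ → QP.*-assoc a (F (proj₁ βγ)) (G (proj₂ βγ)))) (ΣL-*ˡ a _ (splits α))

mulQ-Σ<ʳ : ∀ F (H : ℕ → QSym) n α → mulQ F (λ γ → Σ< (λ k → H k γ) n) α ≡ Σ< (λ k → mulQ F (H k) α) n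
mulQ-Σ<ʳ F H n α = trans (ΣL-cong (splits α) (λ βγ → sym (Σ<-*ˡ (F (proj₁ βγ)) (λ k → H k (proj₂ βγ)) n)))
                        (ΣL-Σ<-comm (λ βγ k → F (proj₁ βγ) * H k (proj₂ βγ)) (splits α) n)

mulQ-identityˡ : ∀ G α → mulQ (eQ 0) G α ≡ G α
mulQ-identityˡ G [] = trans (QP.+-identityʳ (1ℚ * G [])) (QP.*-identityˡ (G []))
mulQ-identityˡ G (zero ∷ α) = trans (mulQ-∷ (eQ 0) G 0 α) (trans (QP.+-identityʳ _) (mulQ-identityˡ (λ γ → G (0 ∷ γ)) α))
mulQ-identityˡ G (suc a ∷ α) = begin
  mulQ (eQ 0) G (suc a ∷ α)
    ≡⟨ mulQ-∷ (eQ 0) G (suc a) α ⟩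
  mulQ (eQ 0) (λ γ → G (suc a ∷ γ)) α + Σ< (λ i → mulQ (λ β → eQ 0 (suc i ∷ β)) (λ γ → G ((a ∸ i) ∷ γ)) α) (suc a)
    ≡⟨ cong₂ _+_ (mulQ-identityˡ (λ γ → G (suc a ∷ γ)) α)
                 (Σ<-0 _ (suc a) (λ i _ → mulQ-zeroˡ (λ β → eQ 0 (suc i ∷ β)) (λ γ → G ((a ∸ i) ∷ γ)) α (λ β → cong [_] (isElementary-0-suc i β)))) ⟩
  G (suc a ∷ α) + 0ℚ
    ≡⟨ QP.+-identityʳ _ ⟩
  G (suc a ∷ α) ∎
  where open ≡-Reasoning

binom-*-shift : ∀ (g : ℕ → ℚ) x {s w} j → s ≤ w → binom s j * g (x ℕ.+ (w ∸ j)) ≡ binom s j * g (x ℕ.+ w ∸ j)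
binom-*-shift g x {s} {w} j s≤w with j ℕ.≤? w
... | yes j≤w = cong (λ t → binom s j * g t) (sym (ℕP.+-∸-assoc x j≤w))
... | no j≰w rewrite binom-< s j (ℕP.≤-<-trans s≤w (ℕP.≰⇒> j≰w)) = trans (QP.*-zeroˡ (g (x ℕ.+ (w ∸ j)))) (sym (QP.*-zeroˡ (g (x ℕ.+ w ∸ j))))

-- A monomial of e_j dividing x^α picks j of the nparts α nonzero exponents of α
-- and lowers each by one.
mulQ-eQ-byWeight : ∀ j (g : ℕ → ℚ) α → mulQ (eQ j) (λ γ → g (weight γ)) α ≡ binom (nparts α) j * g (weight α ∸ j)
mulQ-eQ-byWeight zero g [] = QP.+-identityʳ (1ℚ * g 0)
mulQ-eQ-byWeight (suc j) g [] = QP.+-identityʳ (0ℚ * g 0)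
mulQ-eQ-byWeight j g (zero ∷ α) =
  trans (mulQ-∷ (eQ j) (λ γ → g (weight γ)) 0 α) (trans (QP.+-identityʳ _) (mulQ-eQ-byWeight j g α))
mulQ-eQ-byWeight j g (suc a ∷ α) = begin
  mulQ (eQ j) (λ γ → g (weight γ)) (suc a ∷ α)
    ≡⟨ mulQ-∷ (eQ j) (λ γ → g (weight γ)) (suc a) α ⟩
  lower 0 + (lower 1 + Σ< (λ i → lower (suc (suc i))) a)
    ≡⟨ cong (λ t → lower 0 + (lower 1 + t)) (Σ<-0 _ a (λ i _ → mulQ-zeroˡ (λ β → eQ j (suc (suc i) ∷ β)) (λ γ → g (weight ((a ∸ suc i) ∷ γ))) α (λ β → refl))) ⟩
  lower 0 + (lower 1 + 0ℚ)
    ≡⟨ cong (lower 0 +_) (QP.+-identityʳ (lower 1)) ⟩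
  lower 0 + lower 1
    ≡⟨ by-j j ⟩
  binom (suc s) j * g (suc a ℕ.+ w ∸ j) ∎
  where
    open ≡-Reasoning
    s = nparts α
    w = weight α
    lower : ℕ → ℚ
    lower i = mulQ (λ β → eQ j (i ∷ β)) (λ γ → g (weight ((suc a ∸ i) ∷ γ))) α
    by-j : ∀ j → mulQ (λ β → eQ j (0 ∷ β)) (λ γ → g (suc a ℕ.+ weight γ)) α + mulQ (λ β → eQ j (1 ∷ β)) (λ γ → g (a ℕ.+ weight γ)) α
               ≡ binom (suc s) j * g (suc a ℕ.+ w ∸ j)
    by-j zero = begin
      _ ≡⟨ cong₂ _+_ (mulQ-eQ-byWeight 0 (λ x → g (suc a ℕ.+ x)) α) (mulQ-zeroˡ (λ β → eQ 0 (1 ∷ β)) (λ γ → g (a ℕ.+ weight γ)) α (λ β → cong [_] (isElementary-0-suc 0 β))) ⟩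
      binom s 0 * g (suc a ℕ.+ w) + 0ℚ ≡⟨ trans (QP.+-identityʳ _) (cong (_* g (suc a ℕ.+ w)) (binom-n-0 s)) ⟩
      1ℚ * g (suc a ℕ.+ w) ∎
    by-j (suc j) = begin
      _ ≡⟨ cong₂ _+_ (mulQ-eQ-byWeight (suc j) (λ x → g (suc a ℕ.+ x)) α) (mulQ-eQ-byWeight j (λ x → g (a ℕ.+ x)) α) ⟩
      binom s (suc j) * g (suc a ℕ.+ (w ∸ suc j)) + binom s j * g (a ℕ.+ (w ∸ j))
        ≡⟨ cong₂ _+_ (binom-*-shift g (suc a) (suc j) (nparts≤weight α)) (binom-*-shift g a j (nparts≤weight α)) ⟩
      binom s (suc j) * g (a ℕ.+ w ∸ j) + binom s j * g (a ℕ.+ w ∸ j)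
        ≡⟨ solve 3 (λ x y z → x :* z :+ y :* z := (y :+ x) :* z) refl (binom s (suc j)) (binom s j) (g (a ℕ.+ w ∸ j)) ⟩
      (binom s j + binom s (suc j)) * g (a ℕ.+ w ∸ j) ∎

-- q-integers, q-factorials and q-Stirling numbers at q = c

module QNumbers (c : ℚ) where

  [_]q : ℕ → ℚ
  [ m ]q = eval c (qint m)

  []q-suc : ∀ m → [ suc m ]q ≡ 1ℚ + c * [ m ]q
  []q-suc m = trans (eval-+P c oneP (qP *P qint m)) (cong₂ _+_ (eval-oneP c) (trans (eval-*P c qP (qint m)) (cong (_* [ m ]q) (eval-qP c))))

  []q-+ : ∀ a b → [ a ]q + c ^ a * [ b ]q ≡ [ a ℕ.+ b ]q
  []q-+ zero b = trans (QP.+-identityˡ _) (QP.*-identityˡ _)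
  []q-+ (suc a) b = begin
    [ suc a ]q + c * c ^ a * [ b ]q ≡⟨ cong (λ t → t + c * c ^ a * [ b ]q) ([]q-suc a) ⟩
    1ℚ + c * [ a ]q + c * c ^ a * [ b ]q ≡⟨ solve 4 (λ c x p y → con 1ℚ :+ c :* x :+ c :* p :* y := con 1ℚ :+ c :* (x :+ p :* y)) refl c ([ a ]q) (c ^ a) ([ b ]q) ⟩
    1ℚ + c * ([ a ]q + c ^ a * [ b ]q) ≡⟨ cong (λ t → 1ℚ + c * t) ([]q-+ a b) ⟩
    1ℚ + c * [ a ℕ.+ b ]q ≡⟨ sym ([]q-suc (a ℕ.+ b)) ⟩
    [ suc a ℕ.+ b ]q ∎ where open ≡-Reasoning

  []q-geometric : ∀ m → (1ℚ - c) * [ m ]q ≡ 1ℚ - c ^ m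
  []q-geometric zero = solve 1 (λ c → (con 1ℚ :- c) :* con 0ℚ := con 1ℚ :- con 1ℚ) refl c
  []q-geometric (suc m) = begin
    (1ℚ - c) * [ suc m ]q ≡⟨ cong ((1ℚ - c) *_) ([]q-suc m) ⟩
    (1ℚ - c) * (1ℚ + c * [ m ]q) ≡⟨ solve 2 (λ c x → (con 1ℚ :- c) :* (con 1ℚ :+ c :* x) := con 1ℚ :- c :+ c :* ((con 1ℚ :- c) :* x)) refl c ([ m ]q) ⟩
    1ℚ - c + c * ((1ℚ - c) * [ m ]q) ≡⟨ cong (λ t → 1ℚ - c + c * t) ([]q-geometric m) ⟩
    1ℚ - c + c * (1ℚ - c ^ m) ≡⟨ solve 2 (λ c p → con 1ℚ :- c :+ c :* (con 1ℚ :- p) := con 1ℚ :- c :* p) refl c (c ^ m) ⟩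
    1ℚ - c * c ^ m ∎ where open ≡-Reasoning

  rising : ℕ → ℕ → ℚ
  rising k zero = 1ℚ
  rising k (suc r) = [ suc k ]q * rising (suc k) r

  rising-sucʳ : ∀ k r → rising k (suc r) ≡ rising k r * [ suc (k ℕ.+ r) ]q
  rising-sucʳ k zero = trans (QP.*-identityʳ _) (trans (cong (λ t → [ suc t ]q) (sym (ℕP.+-identityʳ k))) (sym (QP.*-identityˡ _)))
  rising-sucʳ k (suc r) = begin
    [ suc k ]q * rising (suc k) (suc r) ≡⟨ cong ([ suc k ]q *_) (rising-sucʳ (suc k) r) ⟩
    [ suc k ]q * (rising (suc k) r * [ suc (suc k ℕ.+ r) ]q) ≡⟨ sym (QP.*-assoc ([ suc k ]q) (rising (suc k) r) ([ suc (suc k ℕ.+ r) ]q)) ⟩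
    [ suc k ]q * rising (suc k) r * [ suc (suc k ℕ.+ r) ]q ≡⟨ cong (λ t → [ suc k ]q * rising (suc k) r * [ suc t ]q) (sym (ℕP.+-suc k r)) ⟩
    [ suc k ]q * rising (suc k) r * [ suc (k ℕ.+ suc r) ]q ∎ where open ≡-Reasoning

  rising-suc-suc : ∀ k r → rising (suc k) (suc r) ≡ [ suc r ]q * rising (suc k) r + c ^ suc r * rising k (suc r)
  rising-suc-suc k r = begin
    rising (suc k) (suc r) ≡⟨ rising-sucʳ (suc k) r ⟩
    rising (suc k) r * [ suc (suc k ℕ.+ r) ]q ≡⟨ cong (λ t → rising (suc k) r * [ t ]q) idx ⟩
    rising (suc k) r * [ suc r ℕ.+ suc k ]q ≡⟨ cong (rising (suc k) r *_) (sym ([]q-+ (suc r) (suc k))) ⟩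
    rising (suc k) r * ([ suc r ]q + c ^ suc r * [ suc k ]q)
      ≡⟨ solve 4 (λ p a b q → p :* (a :+ b :* q) := a :* p :+ b :* (q :* p)) refl (rising (suc k) r) ([ suc r ]q) (c ^ suc r) ([ suc k ]q) ⟩
    [ suc r ]q * rising (suc k) r + c ^ suc r * rising k (suc r) ∎
    where
      open ≡-Reasoning
      idx : suc (suc k ℕ.+ r) ≡ suc r ℕ.+ suc k
      idx = cong suc (trans (cong suc (ℕP.+-comm k r)) (sym (ℕP.+-suc r k)))

  fact : ℕ → ℚ
  fact r = eval c (qfact r)

  fact-suc : ∀ r → fact (suc r) ≡ [ suc r ]q * fact r
  fact-suc r = eval-*P c (qint (suc r)) (qfact r)

  stirling : ℕ → ℕ → ℚ
  stirling s r = eval c (Sq s r)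

  stirling-suc : ∀ s r → stirling (suc s) (suc r) ≡ stirling s r + [ suc r ]q * stirling s (suc r)
  stirling-suc s r = trans (eval-+P c (Sq s r) _) (cong (stirling s r +_) (eval-*P c (qint (suc r)) (Sq s (suc r))))

  stirling-< : ∀ s r → s < r → stirling s r ≡ 0ℚ
  stirling-< zero (suc r) _ = refl
  stirling-< (suc s) (suc r) (s≤s s<r) = begin
    stirling (suc s) (suc r) ≡⟨ stirling-suc s r ⟩
    stirling s r + [ suc r ]q * stirling s (suc r) ≡⟨ cong₂ (λ a b → a + [ suc r ]q * b) (stirling-< s r s<r) (stirling-< s (suc r) (ℕP.m<n⇒m<1+n s<r)) ⟩
    0ℚ + [ suc r ]q * 0ℚ ≡⟨ solve 1 (λ q → con 0ℚ :+ q :* con 0ℚ := con 0ℚ) refl ([ suc r ]q) ⟩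
    0ℚ ∎ where open ≡-Reasoning

  rhsCoeff : ℕ → ℕ → ℚ
  rhsCoeff s r = (1ℚ - c) ^ (s ∸ r) * stirling s r

  rhsCoeff-< : ∀ s r → s < r → rhsCoeff s r ≡ 0ℚ
  rhsCoeff-< s r s<r = trans (cong ((1ℚ - c) ^ (s ∸ r) *_) (stirling-< s r s<r)) (QP.*-zeroʳ ((1ℚ - c) ^ (s ∸ r)))

  rhsCoeff-suc : ∀ s r → rhsCoeff (suc s) (suc r) ≡ rhsCoeff s r + (1ℚ - c ^ suc r) * rhsCoeff s (suc r)
  rhsCoeff-suc s r with ℕP.<-cmp r s
  ... | tri< r<s _ _ = begin
    (1ℚ - c) ^ (s ∸ r) * stirling (suc s) (suc r) ≡⟨ cong₂ _*_ (cong ((1ℚ - c) ^_) eq1) (stirling-suc s r) ⟩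
    (1ℚ - c) ^ suc (s ∸ suc r) * (stirling s r + [ suc r ]q * stirling s (suc r))
      ≡⟨ solve 5 (λ d p a q b → (d :* p) :* (a :+ q :* b) := (d :* p) :* a :+ (d :* q) :* (p :* b)) refl (1ℚ - c) ((1ℚ - c) ^ (s ∸ suc r)) (stirling s r) ([ suc r ]q) (stirling s (suc r)) ⟩
    (1ℚ - c) ^ suc (s ∸ suc r) * stirling s r + ((1ℚ - c) * [ suc r ]q) * ((1ℚ - c) ^ (s ∸ suc r) * stirling s (suc r))
      ≡⟨ cong₂ (λ a b → (1ℚ - c) ^ a * stirling s r + b * ((1ℚ - c) ^ (s ∸ suc r) * stirling s (suc r))) (sym eq1) ([]q-geometric (suc r)) ⟩
    rhsCoeff s r + (1ℚ - c ^ suc r) * rhsCoeff s (suc r) ∎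
    where open ≡-Reasoning
          eq1 : s ∸ r ≡ suc (s ∸ suc r)
          eq1 = ℕP.+-∸-assoc 1 r<s
  ... | tri≈ _ refl _ = begin
    (1ℚ - c) ^ (s ∸ s) * stirling (suc s) (suc s) ≡⟨ cong ((1ℚ - c) ^ (s ∸ s) *_) (stirling-suc s s) ⟩
    (1ℚ - c) ^ (s ∸ s) * (stirling s s + [ suc s ]q * stirling s (suc s)) ≡⟨ cong (λ t → (1ℚ - c) ^ (s ∸ s) * (stirling s s + [ suc s ]q * t)) (stirling-< s (suc s) ℕP.≤-refl) ⟩
    (1ℚ - c) ^ (s ∸ s) * (stirling s s + [ suc s ]q * 0ℚ) ≡⟨ solve 4 (λ p a q e → p :* (a :+ q :* con 0ℚ) := p :* a :+ e :* (con 0ℚ)) refl ((1ℚ - c) ^ (s ∸ s)) (stirling s s) ([ suc s ]q) (1ℚ - c ^ suc s) ⟩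
    rhsCoeff s s + (1ℚ - c ^ suc s) * 0ℚ ≡⟨ cong (λ t → rhsCoeff s s + (1ℚ - c ^ suc s) * t) (sym (rhsCoeff-< s (suc s) ℕP.≤-refl)) ⟩
    rhsCoeff s s + (1ℚ - c ^ suc s) * rhsCoeff s (suc s) ∎ where open ≡-Reasoning
  ... | tri> _ _ s<r = begin
    rhsCoeff (suc s) (suc r) ≡⟨ rhsCoeff-< (suc s) (suc r) (s≤s s<r) ⟩
    0ℚ ≡⟨ solve 1 (λ e → con 0ℚ := con 0ℚ :+ e :* con 0ℚ) refl (1ℚ - c ^ suc r) ⟩
    0ℚ + (1ℚ - c ^ suc r) * 0ℚ ≡⟨ cong₂ (λ a b → a + (1ℚ - c ^ suc r) * b) (sym (rhsCoeff-< s r s<r)) (sym (rhsCoeff-< s (suc r) (ℕP.m<n⇒m<1+n s<r))) ⟩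
    rhsCoeff s r + (1ℚ - c ^ suc r) * rhsCoeff s (suc r) ∎ where open ≡-Reasoning

  fact*rhsCoeff : ℕ → ℕ → ℚ
  fact*rhsCoeff s r = fact r * rhsCoeff s r

  fact*rhsCoeff-suc : ∀ s r → fact*rhsCoeff (suc s) (suc r) ≡ [ suc r ]q * fact*rhsCoeff s r + (1ℚ - c ^ suc r) * fact*rhsCoeff s (suc r)
  fact*rhsCoeff-suc s r = begin
    fact (suc r) * rhsCoeff (suc s) (suc r) ≡⟨ cong₂ _*_ (fact-suc r) (rhsCoeff-suc s r) ⟩
    [ suc r ]q * fact r * (rhsCoeff s r + ee * rhsCoeff s (suc r))
      ≡⟨ solve 5 (λ q f u e v → q :* f :* (u :+ e :* v) := q :* (f :* u) :+ e :* ((q :* f) :* v)) refl ([ suc r ]q) (fact r) (rhsCoeff s r) ee (rhsCoeff s (suc r)) ⟩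
    [ suc r ]q * (fact r * rhsCoeff s r) + ee * (([ suc r ]q * fact r) * rhsCoeff s (suc r))
      ≡⟨ cong (λ t → [ suc r ]q * (fact r * rhsCoeff s r) + ee * (t * rhsCoeff s (suc r))) (sym (fact-suc r)) ⟩
    [ suc r ]q * fact*rhsCoeff s r + ee * fact*rhsCoeff s (suc r) ∎
    where open ≡-Reasoning
          ee = 1ℚ - c ^ suc r

  altSum-term : ℕ → ℕ → ℕ → ℚ
  altSum-term s r k = sign k * rising k r * binom s (r ℕ.+ k)

  altSum : ℕ → ℕ → ℕ → ℚ
  altSum M s r = Σ< (altSum-term s r) M

  -- Pascal's rule in s, then rising-suc-suc in the shifted terms.
  altSum-rec : ∀ M s r → altSum (suc M) (suc s) (suc r) ≡
                         [ suc r ]q * altSum (suc M) s r - c ^ suc r * altSum M s (suc r) + altSum (suc M) s (suc r)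
  altSum-rec M s r = begin
    altSum (suc M) (suc s) (suc r)
      ≡⟨ Σ<-cong′ (suc M) (λ k → QP.*-distribˡ-+ (sign k * rising k (suc r)) (binom s (r ℕ.+ k)) (binom s (suc r ℕ.+ k))) ⟩
    Σ< (λ k → lowered k + altSum-term s (suc r) k) (suc M)
      ≡⟨ Σ<-+ lowered (altSum-term s (suc r)) (suc M) ⟩
    lowered 0 + Σ< (λ k → lowered (suc k)) M + altSum (suc M) s (suc r)
      ≡⟨ cong (λ t → lowered 0 + t + altSum (suc M) s (suc r)) lowered-tail ⟩
    lowered 0 + ([ suc r ]q * Σ< (λ k → altSum-term s r (suc k)) M - c ^ suc r * altSum M s (suc r)) + altSum (suc M) s (suc r)
      ≡⟨ cong (λ t → t + ([ suc r ]q * Σ< (λ k → altSum-term s r (suc k)) M - c ^ suc r * altSum M s (suc r)) + altSum (suc M) s (suc r)) lowered-0 ⟩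
    [ suc r ]q * altSum-term s r 0 + ([ suc r ]q * Σ< (λ k → altSum-term s r (suc k)) M - c ^ suc r * altSum M s (suc r)) + altSum (suc M) s (suc r)
      ≡⟨ solve 5 (λ q a b x y → q :* a :+ (q :* b :- x) :+ y := q :* (a :+ b) :- x :+ y) refl
           [ suc r ]q (altSum-term s r 0) (Σ< (λ k → altSum-term s r (suc k)) M) (c ^ suc r * altSum M s (suc r)) (altSum (suc M) s (suc r)) ⟩
    [ suc r ]q * altSum (suc M) s r - c ^ suc r * altSum M s (suc r) + altSum (suc M) s (suc r) ∎
    where
      open ≡-Reasoning
      lowered : ℕ → ℚ
      lowered k = sign k * rising k (suc r) * binom s (r ℕ.+ k)
      lowered-0 : lowered 0 ≡ [ suc r ]q * altSum-term s r 0
      lowered-0 = trans (cong (λ t → 1ℚ * t * binom s (r ℕ.+ 0)) (rising-sucʳ 0 r))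
                        (solve 3 (λ p q b → con 1ℚ :* (p :* q) :* b := q :* (con 1ℚ :* p :* b)) refl (rising 0 r) [ suc r ]q (binom s (r ℕ.+ 0)))
      lowered-suc : ∀ k → lowered (suc k) ≡ [ suc r ]q * altSum-term s r (suc k) - c ^ suc r * altSum-term s (suc r) k
      lowered-suc k = begin
        (- sign k) * rising (suc k) (suc r) * binom s (r ℕ.+ suc k)
          ≡⟨ cong (λ t → (- sign k) * t * binom s (r ℕ.+ suc k)) (rising-suc-suc k r) ⟩
        (- sign k) * ([ suc r ]q * rising (suc k) r + c ^ suc r * rising k (suc r)) * binom s (r ℕ.+ suc k)
          ≡⟨ solve 6 (λ a q P1 p P2 C → (:- a) :* (q :* P1 :+ p :* P2) :* C := q :* ((:- a) :* P1 :* C) :- p :* (a :* P2 :* C))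
               refl (sign k) [ suc r ]q (rising (suc k) r) (c ^ suc r) (rising k (suc r)) (binom s (r ℕ.+ suc k)) ⟩
        [ suc r ]q * altSum-term s r (suc k) - c ^ suc r * (sign k * rising k (suc r) * binom s (r ℕ.+ suc k))
          ≡⟨ cong (λ t → [ suc r ]q * altSum-term s r (suc k) - c ^ suc r * (sign k * rising k (suc r) * binom s t)) (ℕP.+-suc r k) ⟩
        [ suc r ]q * altSum-term s r (suc k) - c ^ suc r * altSum-term s (suc r) k ∎
      lowered-tail : Σ< (λ k → lowered (suc k)) M ≡ [ suc r ]q * Σ< (λ k → altSum-term s r (suc k)) M - c ^ suc r * altSum M s (suc r)
      lowered-tail = trans (Σ<-cong′ M lowered-suc)
                       (trans (Σ<-- _ _ M) (cong₂ _-_ (Σ<-*ˡ [ suc r ]q _ M) (Σ<-*ˡ (c ^ suc r) (altSum-term s (suc r)) M)))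

  altSum≡fact*rhsCoeff : ∀ s r M → s < M ℕ.+ r → altSum M s r ≡ fact*rhsCoeff s r
  altSum≡fact*rhsCoeff zero zero (suc M) _ = begin
    1ℚ * 1ℚ * 1ℚ + Σ< (λ k → sign (suc k) * 1ℚ * 0ℚ) M ≡⟨ cong (1ℚ * 1ℚ * 1ℚ +_) (Σ<-0 _ M (λ k _ → QP.*-zeroʳ (sign (suc k) * 1ℚ))) ⟩
    1ℚ ≡⟨ sym (trans (QP.*-identityˡ (1ℚ * 1ℚ)) (QP.*-identityˡ 1ℚ)) ⟩
    1ℚ * (1ℚ * 1ℚ) ≡⟨ sym (cong₂ (λ a b → a * (1ℚ * b)) (eval-oneP c) (eval-oneP c)) ⟩
    fact*rhsCoeff 0 0 ∎ where open ≡-Reasoning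
  altSum≡fact*rhsCoeff zero (suc r) M _ = trans (Σ<-0 _ M (λ k _ → QP.*-zeroʳ (sign k * rising k (suc r))))
                                   (sym (trans (cong (fact (suc r) *_) (QP.*-zeroʳ ((1ℚ - c) ^ 0))) (QP.*-zeroʳ (fact (suc r)))))
  altSum≡fact*rhsCoeff (suc s) zero M h = begin
    altSum M (suc s) 0 ≡⟨ Σ<-cong′ M (λ k → cong (_* binom (suc s) k) (QP.*-identityʳ (sign k))) ⟩
    Σ< (λ k → sign k * binom (suc s) k) M ≡⟨ alternating-binom (suc s) M (subst (suc s <_) (ℕP.+-identityʳ M) h) ⟩
    0ℚ ≡⟨ sym (trans (cong (fact 0 *_) (QP.*-zeroʳ ((1ℚ - c) ^ (suc s)))) (QP.*-zeroʳ (fact 0))) ⟩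
    fact*rhsCoeff (suc s) 0 ∎ where open ≡-Reasoning
  altSum≡fact*rhsCoeff (suc s) (suc r) zero (s≤s h) = sym (trans (cong (fact (suc r) *_) (rhsCoeff-< (suc s) (suc r) (s≤s h))) (QP.*-zeroʳ (fact (suc r))))
  altSum≡fact*rhsCoeff (suc s) (suc r) (suc M) (s≤s h) = begin
    altSum (suc M) (suc s) (suc r)
      ≡⟨ altSum-rec M s r ⟩
    [ suc r ]q * altSum (suc M) s r - c ^ suc r * altSum M s (suc r) + altSum (suc M) s (suc r)
      ≡⟨ cong₂ _+_ (cong₂ (λ a b → [ suc r ]q * a - c ^ suc r * b) (altSum≡fact*rhsCoeff s r (suc M) h1) (altSum≡fact*rhsCoeff s (suc r) M h))
                   (altSum≡fact*rhsCoeff s (suc r) (suc M) h2) ⟩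
    [ suc r ]q * fact*rhsCoeff s r - c ^ suc r * fact*rhsCoeff s (suc r) + fact*rhsCoeff s (suc r)
      ≡⟨ solve 4 (λ q a b p → q :* a :- p :* b :+ b := q :* a :+ (con 1ℚ :- p) :* b) refl [ suc r ]q (fact*rhsCoeff s r) (fact*rhsCoeff s (suc r)) (c ^ suc r) ⟩
    [ suc r ]q * fact*rhsCoeff s r + (1ℚ - c ^ suc r) * fact*rhsCoeff s (suc r)
      ≡⟨ sym (fact*rhsCoeff-suc s r) ⟩
    fact*rhsCoeff (suc s) (suc r) ∎
    where
      open ≡-Reasoning
      h1 : s < suc M ℕ.+ r
      h1 = s≤s (ℕP.≤-pred (subst (suc s ≤_) (ℕP.+-suc M r) h))
      h2 : s < suc M ℕ.+ suc r
      h2 = ℕP.m<n⇒m<1+n h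

-- The inverse of E(t)

oneQ : QSer
oneQ zero = eQ 0
oneQ (suc n) _ = 0ℚ

powQSer : QSer → ℕ → QSer
powQSer A zero = oneQ
powQSer A (suc k) = mulQSer A (powQSer A k)

invQSer : QSer → QSer
invQSer F n α = Σ< (λ k → powQSer (λ m β → oneQ m β - F m β) k n α) (suc n)

IsRightInverseOfE : QSer → Set
IsRightInverseOfE X = ∀ n β → mulQSer eQ X n β ≡ oneQ n β

rightInverseOfE-unique : ∀ {X Y} → IsRightInverseOfE X → IsRightInverseOfE Y → ∀ n β → X n β ≡ Y n β
rightInverseOfE-unique {X} {Y} X⁻¹ Y⁻¹ n = go (suc n) n ℕP.≤-refl
  where
    -- E_0 = 1, so the t^n coefficient of E·Z is Z_n plus terms in Z_0, …, Z_{n-1}.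
    go : ∀ fuel n → n < fuel → ∀ β → X n β ≡ Y n β
    go (suc fuel) n (s≤s n≤fuel) β = +-cancelʳ (rest Y) (X n β) (Y n β) (begin
      X n β + rest Y       ≡⟨ cong (X n β +_) (sym rest≡) ⟩
      X n β + rest X       ≡⟨ expand X ⟩
      mulQSer eQ X n β     ≡⟨ trans (X⁻¹ n β) (sym (Y⁻¹ n β)) ⟩
      mulQSer eQ Y n β     ≡⟨ sym (expand Y) ⟩
      Y n β + rest Y       ∎)
      where
        open ≡-Reasoning
        rest : QSer → ℚ
        rest Z = Σ< (λ j → mulQ (eQ (suc j)) (Z (n ∸ suc j)) β) n
        expand : ∀ Z → Z n β + rest Z ≡ mulQSer eQ Z n β
        expand Z = cong (_+ rest Z) (sym (mulQ-identityˡ (Z n) β))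
        rest≡ : rest X ≡ rest Y
        rest≡ = Σ<-cong n (λ j j<n → mulQ-congʳ (eQ (suc j)) β
                  (go fuel (n ∸ suc j) (ℕP.<-≤-trans (ℕP.∸-monoʳ-< (s≤s z≤n) j<n) n≤fuel)))

mulQSer-identityˡ : ∀ A n β → mulQSer oneQ A n β ≡ A n β
mulQSer-identityˡ A n β = begin
  mulQ (eQ 0) (A n) β + Σ< (λ j → mulQ (λ _ → 0ℚ) (A (n ∸ suc j)) β) n
    ≡⟨ cong₂ _+_ (mulQ-identityˡ (A n) β) (Σ<-0 _ n (λ j _ → mulQ-zeroˡ (λ _ → 0ℚ) (A (n ∸ suc j)) β (λ _ → refl))) ⟩
  A n β + 0ℚ
    ≡⟨ QP.+-identityʳ (A n β) ⟩
  A n β ∎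
  where open ≡-Reasoning

mulQSer--ˡ : ∀ A B C n β → mulQSer (λ m γ → A m γ - B m γ) C n β ≡ mulQSer A C n β - mulQSer B C n β
mulQSer--ˡ A B C n β = trans (Σ<-cong′ (suc n) (λ j → mulQ--ˡ (A j) (B j) (C (n ∸ j)) β)) (Σ<-- (λ j → mulQ (A j) (C (n ∸ j)) β) (λ j → mulQ (B j) (C (n ∸ j)) β) (suc n))

1-E : QSer
1-E m β = oneQ m β - eQ m β

powQSer-1-E-< : ∀ k n β → n < k → powQSer 1-E k n β ≡ 0ℚ
powQSer-1-E-< (suc k) n β (s≤s n≤k) = begin
  mulQ (1-E 0) (powQSer 1-E k n) β + Σ< (λ i → mulQ (1-E (suc i)) (powQSer 1-E k (n ∸ suc i)) β) n
    ≡⟨ cong₂ _+_ (mulQ-zeroˡ (1-E 0) _ β (λ γ → QP.+-inverseʳ (eQ 0 γ)))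
                 (Σ<-0 _ n (λ i i<n → mulQ-zeroʳ (1-E (suc i)) _ β
                              (λ γ → powQSer-1-E-< k (n ∸ suc i) γ (ℕP.<-≤-trans (ℕP.∸-monoʳ-< (s≤s z≤n) i<n) n≤k)))) ⟩
  0ℚ + 0ℚ
    ≡⟨ QP.+-identityˡ 0ℚ ⟩
  0ℚ ∎
  where open ≡-Reasoning

invQSer-E-truncated : ∀ {m n} β → m ≤ n → invQSer eQ m β ≡ Σ< (λ k → powQSer 1-E k m β) (suc n)
invQSer-E-truncated {m} β m≤n = sym (Σ<-extend (λ k → powQSer 1-E k m β) (s≤s m≤n) (λ k m<k → powQSer-1-E-< k m β m<k))

invQSer-E-rightInverse : IsRightInverseOfE (invQSer eQ)
invQSer-E-rightInverse n β = begin
  Σ< (λ j → mulQ (eQ j) (invQSer eQ (n ∸ j)) β) (suc n)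
    ≡⟨ Σ<-cong′ (suc n) (λ j → mulQ-congʳ (eQ j) β (λ γ → invQSer-E-truncated γ (ℕP.m∸n≤m n j))) ⟩
  Σ< (λ j → mulQ (eQ j) (λ γ → Σ< (λ k → P k (n ∸ j) γ) (suc n)) β) (suc n)
    ≡⟨ Σ<-cong′ (suc n) (λ j → mulQ-Σ<ʳ (eQ j) (λ k → P k (n ∸ j)) (suc n) β) ⟩
  Σ< (λ j → Σ< (λ k → mulQ (eQ j) (P k (n ∸ j)) β) (suc n)) (suc n)
    ≡⟨ Σ<-comm (λ j k → mulQ (eQ j) (P k (n ∸ j)) β) (suc n) (suc n) ⟩
  Σ< (λ k → mulQSer eQ (P k) n β) (suc n)
    ≡⟨ Σ<-cong′ (suc n) E*P≡ ⟩
  Σ< (λ k → P k n β - P (suc k) n β) (suc n)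
    ≡⟨ Σ<-telescope (λ k → P k n β) (suc n) ⟩
  oneQ n β - P (suc n) n β
    ≡⟨ cong (λ t → oneQ n β - t) (powQSer-1-E-< (suc n) n β ℕP.≤-refl) ⟩
  oneQ n β - 0ℚ
    ≡⟨ QP.+-identityʳ (oneQ n β) ⟩
  oneQ n β ∎
  where
    open ≡-Reasoning
    P = powQSer 1-E
    E*P≡ : ∀ k → mulQSer eQ (P k) n β ≡ P k n β - P (suc k) n β
    E*P≡ k = begin
      mulQSer eQ (P k) n β
        ≡⟨ Σ<-cong′ (suc n) (λ j → mulQ-congˡ (P k (n ∸ j)) β (λ γ → solve 2 (λ e o → e := o :- (o :- e)) refl (eQ j γ) (oneQ j γ))) ⟩
      mulQSer (λ m γ → oneQ m γ - 1-E m γ) (P k) n β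
        ≡⟨ mulQSer--ˡ oneQ 1-E (P k) n β ⟩
      mulQSer oneQ (P k) n β - P (suc k) n β
        ≡⟨ cong (_- P (suc k) n β) (mulQSer-identityˡ (P k) n β) ⟩
      P k n β - P (suc k) n β ∎

-- Outside r + k ≤ w the binomial coefficient vanishes, since s ≤ w.
binom-*-∸-≡ᵇ : ∀ {s w} r {k N} → s ≤ w → k ≤ N →
               binom s (r ℕ.+ k) * [ w ∸ (r ℕ.+ k) ℕ.≡ᵇ N ∸ k ] ≡ binom s (r ℕ.+ k) * [ w ℕ.≡ᵇ r ℕ.+ N ]
binom-*-∸-≡ᵇ {s} {w} r {k} {N} s≤w k≤N with r ℕ.+ k ℕ.≤? w
... | yes r+k≤w = cong (λ b → binom s (r ℕ.+ k) * [ b ]) (≡ᵇ-cong-⇔ (mk⇔ to from))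
  where
    to : w ∸ (r ℕ.+ k) ≡ N ∸ k → w ≡ r ℕ.+ N
    to eq = begin
      w                            ≡⟨ sym (ℕP.m+[n∸m]≡n r+k≤w) ⟩
      r ℕ.+ k ℕ.+ (w ∸ (r ℕ.+ k))  ≡⟨ cong (r ℕ.+ k ℕ.+_) eq ⟩
      r ℕ.+ k ℕ.+ (N ∸ k)          ≡⟨ ℕP.+-assoc r k (N ∸ k) ⟩
      r ℕ.+ (k ℕ.+ (N ∸ k))        ≡⟨ cong (r ℕ.+_) (ℕP.m+[n∸m]≡n k≤N) ⟩
      r ℕ.+ N                      ∎
      where open ≡-Reasoning
    from : w ≡ r ℕ.+ N → w ∸ (r ℕ.+ k) ≡ N ∸ k
    from refl = ℕP.[m+n]∸[m+o]≡n∸o r N k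
... | no r+k≰w rewrite binom-< s (r ℕ.+ k) (ℕP.≤-<-trans s≤w (ℕP.≰⇒> r+k≰w)) =
  trans (QP.*-zeroˡ [ w ∸ (r ℕ.+ k) ℕ.≡ᵇ N ∸ k ]) (sym (QP.*-zeroˡ [ w ℕ.≡ᵇ r ℕ.+ N ]))

-- The series Σ_n (-1)^n h_n, h_n the complete homogeneous symmetric function.
signedH : QSer
signedH n β = sign n * [ weight β ℕ.≡ᵇ n ]

mulQ-eQ-signedH : ∀ r {k N} β → k ≤ N →
                  mulQ (eQ (r ℕ.+ k)) (signedH (N ∸ k)) β ≡ [ weight β ℕ.≡ᵇ r ℕ.+ N ] * (sign N * (sign k * binom (nparts β) (r ℕ.+ k)))
mulQ-eQ-signedH r {k} {N} β k≤N = begin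
  mulQ (eQ (r ℕ.+ k)) (signedH (N ∸ k)) β
    ≡⟨ mulQ-eQ-byWeight (r ℕ.+ k) (λ x → sign (N ∸ k) * [ x ℕ.≡ᵇ N ∸ k ]) β ⟩
  C * (sign (N ∸ k) * [ weight β ∸ (r ℕ.+ k) ℕ.≡ᵇ N ∸ k ])
    ≡⟨ solve 3 (λ C x y → C :* (x :* y) := x :* (C :* y)) refl C (sign (N ∸ k)) _ ⟩
  sign (N ∸ k) * (C * [ weight β ∸ (r ℕ.+ k) ℕ.≡ᵇ N ∸ k ])
    ≡⟨ cong₂ _*_ (sign-∸ k≤N) (binom-*-∸-≡ᵇ r (nparts≤weight β) k≤N) ⟩
  sign N * sign k * (C * [ weight β ℕ.≡ᵇ r ℕ.+ N ])
    ≡⟨ solve 4 (λ a b C i → a :* b :* (C :* i) := i :* (a :* (b :* C))) refl (sign N) (sign k) C [ weight β ℕ.≡ᵇ r ℕ.+ N ] ⟩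
  [ weight β ℕ.≡ᵇ r ℕ.+ N ] * (sign N * (sign k * C)) ∎
  where
    open ≡-Reasoning
    C = binom (nparts β) (r ℕ.+ k)

nparts≡0⇒weight≡0 : ∀ β → nparts β ≡ 0 → weight β ≡ 0
nparts≡0⇒weight≡0 [] _ = refl
nparts≡0⇒weight≡0 (zero ∷ β) eq = nparts≡0⇒weight≡0 β eq

oneQ-byWeight : ∀ n β → [ weight β ℕ.≡ᵇ n ] * (sign n * [ nparts β ℕ.≡ᵇ 0 ]) ≡ oneQ n β
oneQ-byWeight zero β = begin
  [ weight β ℕ.≡ᵇ 0 ] * (1ℚ * [ nparts β ℕ.≡ᵇ 0 ])
    ≡⟨ ≡ᵇ-guard {weight β} {0} (λ w≡0 → cong (λ b → 1ℚ * [ b ]) (≡ᵇ-true (ℕP.n≤0⇒n≡0 (subst (nparts β ≤_) w≡0 (nparts≤weight β))))) ⟩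
  [ weight β ℕ.≡ᵇ 0 ] * 1ℚ
    ≡⟨ trans (QP.*-identityʳ _) (cong [_] (sym (isElementary-0 β))) ⟩
  eQ 0 β ∎
  where open ≡-Reasoning
oneQ-byWeight (suc n) β = begin
  [ weight β ℕ.≡ᵇ suc n ] * (sign (suc n) * [ nparts β ℕ.≡ᵇ 0 ])
    ≡⟨ ≡ᵇ-guard {weight β} {suc n} (λ w≡1+n → cong (λ b → sign (suc n) * [ b ]) (≡ᵇ-false (λ s≡0 → ℕP.0≢1+n (trans (sym (nparts≡0⇒weight≡0 β s≡0)) w≡1+n)))) ⟩
  [ weight β ℕ.≡ᵇ suc n ] * (sign (suc n) * 0ℚ)
    ≡⟨ solve 2 (λ a b → a :* (b :* con 0ℚ) := con 0ℚ) refl [ weight β ℕ.≡ᵇ suc n ] (sign (suc n)) ⟩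
  0ℚ ∎
  where open ≡-Reasoning

signedH-rightInverse : IsRightInverseOfE signedH
signedH-rightInverse n β = begin
  Σ< (λ j → mulQ (eQ j) (signedH (n ∸ j)) β) (suc n)
    ≡⟨ Σ<-cong (suc n) (λ j j<1+n → mulQ-eQ-signedH 0 β (ℕP.≤-pred j<1+n)) ⟩
  Σ< (λ j → [ w ℕ.≡ᵇ n ] * (sign n * (sign j * binom s j))) (suc n)
    ≡⟨ trans (Σ<-*ˡ [ w ℕ.≡ᵇ n ] (λ j → sign n * (sign j * binom s j)) (suc n))
             (cong ([ w ℕ.≡ᵇ n ] *_) (Σ<-*ˡ (sign n) (λ j → sign j * binom s j) (suc n))) ⟩
  [ w ℕ.≡ᵇ n ] * (sign n * Σ< (λ j → sign j * binom s j) (suc n))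
    ≡⟨ ≡ᵇ-guard {w} {n} (λ w≡n → cong (sign n *_) (alternating-binom s (suc n) (s≤s (subst (s ≤_) w≡n (nparts≤weight β))))) ⟩
  [ w ℕ.≡ᵇ n ] * (sign n * [ s ℕ.≡ᵇ 0 ])
    ≡⟨ oneQ-byWeight n β ⟩
  oneQ n β ∎
  where
    open ≡-Reasoning
    w = weight β
    s = nparts β

invQSer-E≡signedH : ∀ n β → invQSer eQ n β ≡ signedH n β
invQSer-E≡signedH = rightInverseOfE-unique invQSer-E-rightInverse signedH-rightInverse

-- Both sides at q = c

module _ (c : ℚ) where
  open AtPoint c
  open QNumbers c

  oneSer⇓ : oneSer ⇓Ser oneQ
  oneSer⇓ zero = e⇓ c 0
  oneSer⇓ (suc n) α = ⇓-0K

  powSer⇓ : ∀ {A a} k → A ⇓Ser a → powSer A k ⇓Ser powQSer a k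
  powSer⇓ zero A⇓a = oneSer⇓
  powSer⇓ (suc k) A⇓a = ⇓Ser-mulSer A⇓a (powSer⇓ k A⇓a)

  invSer⇓ : ∀ {F f} → F ⇓Ser f → invSer F ⇓Ser invQSer f
  invSer⇓ {F} {f} F⇓f n α =
    ⇓-≡ (⇓S-sumS (upTo (suc n)) (λ k → powSer⇓ k (⇓Ser-subSer oneSer⇓ F⇓f) n) α)
        (ΣL-upTo (λ k → powQSer (λ m β → oneQ m β - f m β) k n α) (suc n))

  rhs⇓ : ∀ n r → r ≤ n → rhs n r ⇓S (λ α → [ weight α ℕ.≡ᵇ n ] * rhsCoeff (nparts α) r)
  rhs⇓ n r r≤n α = ⇓-≡ (⇓S-sumS (rangeFromTo r n) (λ j β → ⇓-*K (⇓-≡ (⇓-ofP (powP (oneP +P negP qP) (j ∸ r) *P Sq j r)) (coeff≡ j)) (p⇓ c n j β)) α) (begin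
    ΣL (λ j → rhsCoeff j r * ([ w ℕ.≡ᵇ n ] * [ s ℕ.≡ᵇ j ])) (map (r ℕ.+_) (upTo (suc N)))
      ≡⟨ trans (ΣL-map (λ j → rhsCoeff j r * ([ w ℕ.≡ᵇ n ] * [ s ℕ.≡ᵇ j ])) (r ℕ.+_) (upTo (suc N)))
               (ΣL-upTo (λ i → rhsCoeff (r ℕ.+ i) r * ([ w ℕ.≡ᵇ n ] * [ s ℕ.≡ᵇ r ℕ.+ i ])) (suc N)) ⟩
    Σ< (λ i → rhsCoeff (r ℕ.+ i) r * ([ w ℕ.≡ᵇ n ] * [ s ℕ.≡ᵇ r ℕ.+ i ])) (suc N)
      ≡⟨ Σ<-cong′ (suc N) (λ i → solve 3 (λ x b y → x :* (b :* y) := b :* (x :* y)) refl (rhsCoeff (r ℕ.+ i) r) [ w ℕ.≡ᵇ n ] [ s ℕ.≡ᵇ r ℕ.+ i ]) ⟩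
    Σ< (λ i → [ w ℕ.≡ᵇ n ] * (rhsCoeff (r ℕ.+ i) r * [ s ℕ.≡ᵇ r ℕ.+ i ])) (suc N)
      ≡⟨ Σ<-*ˡ [ w ℕ.≡ᵇ n ] (λ i → rhsCoeff (r ℕ.+ i) r * [ s ℕ.≡ᵇ r ℕ.+ i ]) (suc N) ⟩
    [ w ℕ.≡ᵇ n ] * Σ< (λ i → rhsCoeff (r ℕ.+ i) r * [ s ℕ.≡ᵇ r ℕ.+ i ]) (suc N)
      ≡⟨ ≡ᵇ-guard {w} {n} (λ w≡n → Σ<-select-from (λ j → rhsCoeff j r) r N s (λ j j<r → rhsCoeff-< j r j<r) (subst (s ≤_) (trans w≡n (sym (ℕP.m+[n∸m]≡n r≤n))) (nparts≤weight α))) ⟩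
    [ w ℕ.≡ᵇ n ] * rhsCoeff s r ∎)
    where
      open ≡-Reasoning
      N = n ∸ r
      w = weight α
      s = nparts α
      coeff≡ : ∀ j → eval c (powP (oneP +P negP qP) (j ∸ r) *P Sq j r) ≡ rhsCoeff j r
      coeff≡ j = trans (eval-*P c (powP (oneP +P negP qP) (j ∸ r)) (Sq j r))
                       (cong (_* stirling j r) (trans (eval-powP c (oneP +P negP qP) (j ∸ r)) (cong (_^ (j ∸ r)) (eval-1-q c))))

module AtLargePoint (c : ℚ) (1<c : 1ℚ ℚ.< c) where
  open AtPoint c
  open QNumbers c

  c-1≢0 : c - 1ℚ ≢ 0ℚ
  c-1≢0 c-1≡0 = QP.<-irrefl (sym (x-y≡0⇒x≡y c 1ℚ c-1≡0)) 1<c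

  0≤[]q : ∀ m → 0ℚ ℚ.≤ [ m ]q
  0≤[]q zero = QP.≤-refl
  0≤[]q (suc m) = subst (0ℚ ℚ.≤_) (sym ([]q-suc m)) (QP.<⇒≤ (0<1+x _ (0≤x*y 0≤c (0≤[]q m))))
    where 0≤c = QP.<⇒≤ (QP.<-trans (QP.positive⁻¹ 1ℚ) 1<c)

  []q-suc≢0 : ∀ m → [ suc m ]q ≢ 0ℚ
  []q-suc≢0 m [1+m]≡0 = QP.<-irrefl (sym (trans (sym ([]q-suc m)) [1+m]≡0))
                                   (0<1+x _ (0≤x*y (QP.<⇒≤ (QP.<-trans (QP.positive⁻¹ 1ℚ) 1<c)) (0≤[]q m)))

  fact≢0 : ∀ r → fact r ≢ 0ℚ
  fact≢0 zero 1≡0 = QP.1≢0 (trans (sym (eval-oneP c)) 1≡0)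
  fact≢0 (suc r) = subst (_≢ 0ℚ) (sym (fact-suc r)) (*-≢0 _ _ ([]q-suc≢0 r) (fact≢0 r))

  q-difference : ∀ m x → inv (c - 1ℚ) * (c ^ m * x + - x) ≡ [ m ]q * x
  q-difference m x = begin
    inv (c - 1ℚ) * (c ^ m * x + - x)
      ≡⟨ cong (λ p → inv (c - 1ℚ) * (p * x + - x)) c^m≡ ⟩
    inv (c - 1ℚ) * ((1ℚ - (1ℚ - c) * [ m ]q) * x + - x)
      ≡⟨ solve 4 (λ i c q x → i :* ((con 1ℚ :- (con 1ℚ :- c) :* q) :* x :+ :- x) := ((c :- con 1ℚ) :* i) :* (q :* x)) refl (inv (c - 1ℚ)) c [ m ]q x ⟩
    ((c - 1ℚ) * inv (c - 1ℚ)) * ([ m ]q * x)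
      ≡⟨ trans (cong (_* ([ m ]q * x)) (*-inv (c - 1ℚ) c-1≢0)) (QP.*-identityˡ _) ⟩
    [ m ]q * x ∎
    where
      open ≡-Reasoning
      c^m≡ : c ^ m ≡ 1ℚ - (1ℚ - c) * [ m ]q
      c^m≡ = trans (solve 1 (λ p → p := con 1ℚ :- (con 1ℚ :- p)) refl (c ^ m)) (cong (λ t → 1ℚ - t) (sym ([]q-geometric m)))

  Dq⇓ : ∀ {F f} → F ⇓Ser f → Dq F ⇓Ser (λ n β → [ suc n ]q * f (suc n) β)
  Dq⇓ {f = f} F⇓f n β =
    ⇓-≡ (⇓-*K (⇓-invP (qP +P negP oneP) (subst (_≢ 0ℚ) (sym (eval-q-1 c)) c-1≢0))
              (⇓-+K (⇓-*K (⇓-ofP (powP qP (suc n))) (F⇓f (suc n) β)) (⇓-negK (F⇓f (suc n) β))))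
        (trans (cong₂ (λ a b → inv a * (b * f (suc n) β + - f (suc n) β)) (eval-q-1 c) (trans (eval-powP c qP (suc n)) (cong (_^ suc n) (eval-qP c))))
               (q-difference (suc n) (f (suc n) β)))

  DqPow-E⇓ : ∀ r → DqPow r E ⇓Ser (λ k β → rising k r * eQ (k ℕ.+ r) β)
  DqPow-E⇓ zero k β = ⇓-≡ (e⇓ c k β) (trans (cong (λ j → eQ j β) (sym (ℕP.+-identityʳ k))) (sym (QP.*-identityˡ _)))
  DqPow-E⇓ (suc r) k β = ⇓-≡ (Dq⇓ (DqPow-E⇓ r) k β) (begin
    [ suc k ]q * (rising (suc k) r * eQ (suc k ℕ.+ r) β)  ≡⟨ sym (QP.*-assoc [ suc k ]q (rising (suc k) r) _) ⟩
    rising k (suc r) * eQ (suc k ℕ.+ r) β                 ≡⟨ cong (λ j → rising k (suc r) * eQ j β) (sym (ℕP.+-suc k r)) ⟩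
    rising k (suc r) * eQ (k ℕ.+ suc r) β                 ∎)
    where open ≡-Reasoning

  pqSeriesQ : ℕ → QSer
  pqSeriesQ r = mulQSer (λ k β → inv (fact r) * (rising k r * eQ (k ℕ.+ r) β)) (invQSer eQ)

  pqSeries⇓ : ∀ r → pqSeries r ⇓Ser pqSeriesQ r
  pqSeries⇓ r = ⇓Ser-mulSer (λ k β → ⇓-*K (⇓-invP (qfact r) (fact≢0 r)) (DqPow-E⇓ r k β)) (invSer⇓ c (e⇓ c))

  pqSeriesQ-term : ∀ {N} r k α → k ≤ N →
                   mulQ (λ β → inv (fact r) * (rising k r * eQ (k ℕ.+ r) β)) (invQSer eQ (N ∸ k)) α
                   ≡ [ weight α ℕ.≡ᵇ r ℕ.+ N ] * sign N * (inv (fact r) * altSum-term (nparts α) r k)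
  pqSeriesQ-term {N} r k α k≤N = begin
    mulQ (λ β → inv (fact r) * (rising k r * eQ (k ℕ.+ r) β)) (invQSer eQ (N ∸ k)) α
      ≡⟨ mulQ-congˡ (invQSer eQ (N ∸ k)) α (λ β → trans (sym (QP.*-assoc (inv (fact r)) (rising k r) (eQ (k ℕ.+ r) β)))
                                                         (cong (λ j → inv (fact r) * rising k r * eQ j β) (ℕP.+-comm k r))) ⟩
    mulQ (λ β → inv (fact r) * rising k r * eQ (r ℕ.+ k) β) (invQSer eQ (N ∸ k)) α
      ≡⟨ trans (mulQ-*ˡ (inv (fact r) * rising k r) (eQ (r ℕ.+ k)) _ α)
               (cong (inv (fact r) * rising k r *_) (mulQ-congʳ (eQ (r ℕ.+ k)) α (invQSer-E≡signedH (N ∸ k)))) ⟩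
    inv (fact r) * rising k r * mulQ (eQ (r ℕ.+ k)) (signedH (N ∸ k)) α
      ≡⟨ cong (inv (fact r) * rising k r *_) (mulQ-eQ-signedH r α k≤N) ⟩
    inv (fact r) * rising k r * ([ weight α ℕ.≡ᵇ r ℕ.+ N ] * (sign N * (sign k * binom (nparts α) (r ℕ.+ k))))
      ≡⟨ solve 6 (λ i R b σ σk C → i :* R :* (b :* (σ :* (σk :* C))) := b :* σ :* (i :* (σk :* R :* C))) refl
           (inv (fact r)) (rising k r) [ weight α ℕ.≡ᵇ r ℕ.+ N ] (sign N) (sign k) (binom (nparts α) (r ℕ.+ k)) ⟩
    [ weight α ℕ.≡ᵇ r ℕ.+ N ] * sign N * (inv (fact r) * altSum-term (nparts α) r k) ∎
    where open ≡-Reasoning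

  pqSeriesQ≡altSum : ∀ r N α → pqSeriesQ r N α ≡ [ weight α ℕ.≡ᵇ r ℕ.+ N ] * sign N * (inv (fact r) * altSum (suc N) (nparts α) r)
  pqSeriesQ≡altSum r N α =
    trans (Σ<-cong (suc N) (λ k k<1+N → pqSeriesQ-term r k α (ℕP.≤-pred k<1+N)))
          (trans (Σ<-*ˡ ([ weight α ℕ.≡ᵇ r ℕ.+ N ] * sign N) (λ k → inv (fact r) * altSum-term (nparts α) r k) (suc N))
                 (cong ([ weight α ℕ.≡ᵇ r ℕ.+ N ] * sign N *_) (Σ<-*ˡ (inv (fact r)) (altSum-term (nparts α) r) (suc N))))

  pq-value : ∀ n r α → r ≤ n →
             sign (n ∸ r) * pqSeriesQ r (n ∸ r) α ≡ [ weight α ℕ.≡ᵇ n ] * rhsCoeff (nparts α) r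
  pq-value n r α r≤n = begin
    sign N * pqSeriesQ r N α
      ≡⟨ cong (sign N *_) (pqSeriesQ≡altSum r N α) ⟩
    sign N * ([ w ℕ.≡ᵇ r ℕ.+ N ] * sign N * A)
      ≡⟨ solve 3 (λ σ b a → σ :* (b :* σ :* a) := b :* a :* (σ :* σ)) refl (sign N) [ w ℕ.≡ᵇ r ℕ.+ N ] A ⟩
    [ w ℕ.≡ᵇ r ℕ.+ N ] * A * (sign N * sign N)
      ≡⟨ trans (cong ([ w ℕ.≡ᵇ r ℕ.+ N ] * A *_) (sign-*-sign N)) (QP.*-identityʳ _) ⟩
    [ w ℕ.≡ᵇ r ℕ.+ N ] * A
      ≡⟨ cong (λ m → [ w ℕ.≡ᵇ m ] * A) r+N≡n ⟩
    [ w ℕ.≡ᵇ n ] * A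
      ≡⟨ ≡ᵇ-guard {w} {n} (λ w≡n → trans (cong (inv (fact r) *_) (altSum≡fact*rhsCoeff s r (suc N) (s<1+N+r w≡n))) inv-cancel) ⟩
    [ w ℕ.≡ᵇ n ] * rhsCoeff s r ∎
    where
      open ≡-Reasoning
      N = n ∸ r
      w = weight α
      s = nparts α
      A = inv (fact r) * altSum (suc N) s r
      r+N≡n : r ℕ.+ N ≡ n
      r+N≡n = ℕP.m+[n∸m]≡n r≤n
      s<1+N+r : w ≡ n → s < suc N ℕ.+ r
      s<1+N+r refl = s≤s (subst (s ≤_) (trans (sym r+N≡n) (ℕP.+-comm r N)) (nparts≤weight α))
      inv-cancel : inv (fact r) * (fact r * rhsCoeff s r) ≡ rhsCoeff s r
      inv-cancel = trans (solve 3 (λ i f x → i :* (f :* x) := (f :* i) :* x) refl (inv (fact r)) (fact r) (rhsCoeff s r))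
                         (trans (cong (_* rhsCoeff s r) (*-inv (fact r) (fact≢0 r))) (QP.*-identityˡ _))

  pq⇓ : ∀ n r → r ≤ n → pq n r ⇓S (λ α → [ weight α ℕ.≡ᵇ n ] * rhsCoeff (nparts α) r)
  pq⇓ n r r≤n α =
    ⇓-≡ (⇓-*K (⇓-ofP (powP (negP oneP) (n ∸ r))) (pqSeries⇓ r (n ∸ r) α))
        (trans (cong (_* pqSeriesQ r (n ∸ r) α) (trans (eval-[-1]^ c (n ∸ r)) ([-1]^≡sign (n ∸ r)))) (pq-value n r α r≤n))

fromℕ : ℕ → ℚ
fromℕ zero = 0ℚ
fromℕ (suc n) = 1ℚ + fromℕ n

0≤fromℕ : ∀ k → 0ℚ ℚ.≤ fromℕ k
0≤fromℕ zero = QP.≤-refl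
0≤fromℕ (suc k) = subst (ℚ._≤ 1ℚ + fromℕ k) (QP.+-identityˡ 0ℚ) (QP.+-mono-≤ (QP.<⇒≤ (QP.positive⁻¹ 1ℚ)) (0≤fromℕ k))

fromℕ-mono-< : ∀ {k n} → k ℕ.< n → fromℕ k ℚ.< fromℕ n
fromℕ-mono-< {k} {suc n} (s≤s k≤n) with ℕP.m≤n⇒m<n∨m≡n k≤n
... | inj₁ k<n = QP.<-trans (fromℕ-mono-< k<n) (x<1+x (fromℕ n))
... | inj₂ refl = x<1+x (fromℕ k)

point : ℕ → ℚ
point k = fromℕ (suc (suc k))

point-injective : ∀ {k n} → k ℕ.< n → point k ≢ point n
point-injective k<n = QP.<⇒≢ (fromℕ-mono-< (ℕ.s≤s (ℕ.s≤s k<n)))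

1<point : ∀ k → 1ℚ ℚ.< point k
1<point k = subst (ℚ._< point k) (QP.+-identityʳ 1ℚ) (QP.+-monoʳ-< 1ℚ (0<1+x (fromℕ k) (0≤fromℕ k)))

theorem4p1 : (n r : ℕ) → 1 ≤ r → r ≤ n → pq n r ≈S rhs n r
theorem4p1 n r _ r≤n α =
  ≈K-byEvaluation point point-injective (pq n r α) (rhs n r α)
    (λ k → [ weight α ℕ.≡ᵇ n ] * QNumbers.rhsCoeff (point k) (nparts α) r)
    (λ k → AtLargePoint.pq⇓ (point k) (1<point k) n r r≤n α)
    (λ k → rhs⇓ (point k) n r r≤n α)
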